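{- Let $F$ be a finite connected simple graph and let $R$ be a set of pendant edges of $F$. Suppose the rooted graph $L(F)_R$ admits a valid decomposition $\mathcal{D}$, and there exist a simple graph $F'$ and an isomorphism $I(\mathcal{D})\cong L(F')$ under which each edge part of $\mathcal{D}$ corresponds to a pendant edge of $F'$. If the diamond graph is not an induced subgraph of $F$ and the clique number of $F$ is $3$, then the incidence graph of $\mathcal{D}$ is isomorphic to $\Gamma_c$.
   Context: $L(\cdot)$ denotes the line graph; $L(F)_R$ is $L(F)$ with root set $R$. A pendant edge is an edge with an endpoint of degree $1$. The diamond graph is $K_4$ minus an edge. A valid decomposition of a rooted graph $G_R$ is a partition of $E(G)$ into parts each a triangle or a single edge (edge part), identified with vertex sets, such that every non-root vertex lies in exactly $3$ parts and every root in exactly $2$ parts. $I(\mathcal{D})$ is the graph on $\mathcal{D}$ in which two parts are adjacent iff they intersect. The incidence graph of a family $\mathcal{B}$ of subsets is the bipartite graph with parts $\bigcup\mathcal{B}$ and $\mathcal{B}$, $p\sim B$ iff $p\in B$. $\Gamma_c$ is the incidence graph of $\{a,b,c\},\{a,d,g\},\{a,e,f\},\{b,e\},\{b,f\},\{c,d\},\{c,g\}$ on $\{a,\dots,g\}$. -}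

module Defs where

open import Data.Nat using (ℕ; zero; suc; _≤_)
open import Data.Fin using (Fin; zero; suc; _<_; #_)
open import Data.Bool using (Bool; true; false)
open import Data.List using (List; []; _∷_; length; filterᵇ; allFin)
open import Data.List.Membership.Propositional using (_∈_)
open import Data.Product using (Σ; ∃; _×_; _,_; proj₁; proj₂)
open import Data.Sum using (_⊎_; inj₁; inj₂)
open import Data.Empty using (⊥)
open import Data.Unit using (⊤)
open import Relation.Nullary using (¬_)
open import Relation.Binary.PropositionalEquality using (_≡_; _≢_)
open import Relation.Binary.Construct.Closure.ReflexiveTransitive using (Star)
open import Function.Bundles using (_↔_; _⇔_; Inverse)

record Graph : Set₁ where
  field
    V   : Set
    Adj : V → V → Set
open Graph public

Iso : Graph → Graph → Set
Iso G H = Σ (V G ↔ V H) λ φ →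
  ∀ x y → Adj G x y ⇔ Adj H (Inverse.to φ x) (Inverse.to φ y)

record FinGraph : Set where
  field
    n     : ℕ
    adj   : Fin n → Fin n → Bool
    adj-sym   : ∀ i j → adj i j ≡ adj j i
    adj-irrefl : ∀ i → adj i i ≡ false
open FinGraph public

toGraph : FinGraph → Graph
toGraph G = record { V = Fin (n G) ; Adj = λ u v → adj G u v ≡ true }

Connected : FinGraph → Set
Connected G = ∀ u v → Star (λ x y → adj G x y ≡ true) u v

degree : (G : FinGraph) → Fin (n G) → ℕ
degree G v = length (filterᵇ (adj G v) (allFin (n G)))

-- edges of G as unordered pairs {u,v}, stored with u < v
Edge : FinGraph → Set
Edge G = Σ (Fin (n G) × Fin (n G)) λ p → (proj₁ p < proj₂ p) × (adj G (proj₁ p) (proj₂ p) ≡ true)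

IsEndpoint : (G : FinGraph) → Fin (n G) → Edge G → Set
IsEndpoint G w e = (w ≡ proj₁ (proj₁ e)) ⊎ (w ≡ proj₂ (proj₁ e))

Pendant : (G : FinGraph) → Edge G → Set
Pendant G e = (degree G (proj₁ (proj₁ e)) ≡ 1) ⊎ (degree G (proj₂ (proj₁ e)) ≡ 1)

LAdj : (G : FinGraph) → Edge G → Edge G → Set
LAdj G e f = (e ≢ f) × ∃ λ w → IsEndpoint G w e × IsEndpoint G w f

LineGraph : FinGraph → Graph
LineGraph G = record { V = Edge G ; Adj = LAdj G }

InducedSub : FinGraph → FinGraph → Set
InducedSub H G = Σ (Fin (n H) → Fin (n G)) λ f →
  (∀ i j → f i ≡ f j → i ≡ j) × (∀ i j → adj G (f i) (f j) ≡ adj H i j)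

Clique : (G : FinGraph) → ℕ → Set
Clique G s = Σ (Fin s → Fin (n G)) λ f →
  (∀ i j → f i ≡ f j → i ≡ j) × (∀ i j → i ≢ j → adj G (f i) (f j) ≡ true)

CliqueNumber : FinGraph → ℕ → Set
CliqueNumber G w = Clique G w × (∀ s → Clique G s → s ≤ w)

-- diamond = K4 minus the edge {2,3}
diamondAdj : Fin 4 → Fin 4 → Bool
diamondAdj zero zero = false
diamondAdj zero _ = true
diamondAdj (suc zero) (suc zero) = false
diamondAdj (suc zero) _ = true
diamondAdj (suc (suc zero)) zero = true
diamondAdj (suc (suc zero)) (suc zero) = true
diamondAdj (suc (suc zero)) _ = false
diamondAdj (suc (suc (suc zero))) zero = true
diamondAdj (suc (suc (suc zero))) (suc zero) = true
diamondAdj (suc (suc (suc zero))) _ = false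

diamond : FinGraph
diamond = record
  { n = 4 ; adj = diamondAdj
  ; adj-sym = λ { zero zero → _≡_.refl ; zero (suc zero) → _≡_.refl ; zero (suc (suc zero)) → _≡_.refl
                ; zero (suc (suc (suc zero))) → _≡_.refl
                ; (suc zero) zero → _≡_.refl ; (suc zero) (suc zero) → _≡_.refl
                ; (suc zero) (suc (suc zero)) → _≡_.refl ; (suc zero) (suc (suc (suc zero))) → _≡_.refl
                ; (suc (suc zero)) zero → _≡_.refl ; (suc (suc zero)) (suc zero) → _≡_.refl
                ; (suc (suc zero)) (suc (suc zero)) → _≡_.refl ; (suc (suc zero)) (suc (suc (suc zero))) → _≡_.refl
                ; (suc (suc (suc zero))) zero → _≡_.refl ; (suc (suc (suc zero))) (suc zero) → _≡_.refl
                ; (suc (suc (suc zero))) (suc (suc zero)) → _≡_.refl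
                ; (suc (suc (suc zero))) (suc (suc (suc zero))) → _≡_.refl }
  ; adj-irrefl = λ { zero → _≡_.refl ; (suc zero) → _≡_.refl ; (suc (suc zero)) → _≡_.refl
                   ; (suc (suc (suc zero))) → _≡_.refl } }

ExactlyN : {N : ℕ} → ℕ → (Fin N → Set) → Set
ExactlyN {N} k P = Σ (Fin k → Fin N) λ f →
  (∀ i j → f i ≡ f j → i ≡ j) × (∀ i → P (f i)) × (∀ m → P m → ∃ λ i → f i ≡ m)

-- Parts of a decomposition: triangles or single edges (identified with vertex sets)

data Part (E : Set) : Set where
  tri : E → E → E → Part E
  edg : E → E → Part E

_∈P_ : {E : Set} → E → Part E → Set
x ∈P tri a b c = (x ≡ a) ⊎ (x ≡ b) ⊎ (x ≡ c)
x ∈P edg a b = (x ≡ a) ⊎ (x ≡ b)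

IsEdgePart : {E : Set} → Part E → Set
IsEdgePart (tri _ _ _) = ⊥
IsEdgePart (edg _ _) = ⊤

PartValid : (Γ : Graph) → Part (V Γ) → Set
PartValid Γ (tri a b c) = Adj Γ a b × Adj Γ b c × Adj Γ a c
PartValid Γ (edg a b) = Adj Γ a b

-- valid decomposition of the rooted graph Γ_R (edges of Γ are the sets {x,y} with Adj x y)
record ValidDecomposition (Γ : Graph) (R : V Γ → Set) : Set where
  field
    k     : ℕ
    part  : Fin k → Part (V Γ)
    valid : ∀ i → PartValid Γ (part i)
    partition : ∀ x y → Adj Γ x y → ExactlyN 1 (λ i → (x ∈P part i) × (y ∈P part i))
    roots     : ∀ x → R x → ExactlyN 2 (λ i → x ∈P part i)
    nonroots  : ∀ x → ¬ R x → ExactlyN 3 (λ i → x ∈P part i)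
open ValidDecomposition public

IGraph : {Γ : Graph} {R : V Γ → Set} → ValidDecomposition Γ R → Graph
IGraph D = record
  { V = Fin (k D)
  ; Adj = λ i j → (i ≢ j) × ∃ λ x → (x ∈P part D i) × (x ∈P part D j) }

IncAdj : {P B : Set} → (P → B → Set) → P ⊎ B → P ⊎ B → Set
IncAdj mem (inj₁ p) (inj₂ b) = mem p b
IncAdj mem (inj₂ b) (inj₁ p) = mem p b
IncAdj mem (inj₁ _) (inj₁ _) = ⊥
IncAdj mem (inj₂ _) (inj₂ _) = ⊥

-- point set ⋃D is taken to be V Γ (every vertex lies in ≥ 2 parts for a valid decomposition)
IncGraph : {Γ : Graph} {R : V Γ → Set} → ValidDecomposition Γ R → Graph
IncGraph {Γ} D = record { V = V Γ ⊎ Fin (k D) ; Adj = IncAdj (λ x i → x ∈P part D i) }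

-- Γ_c: points a..g = 0..6
Γc-blocks : Fin 7 → List (Fin 7)
Γc-blocks zero = (# 0) ∷ (# 1) ∷ (# 2) ∷ []
Γc-blocks (suc zero) = (# 0) ∷ (# 3) ∷ (# 6) ∷ []
Γc-blocks (suc (suc zero)) = (# 0) ∷ (# 4) ∷ (# 5) ∷ []
Γc-blocks (suc (suc (suc zero))) = (# 1) ∷ (# 4) ∷ []
Γc-blocks (suc (suc (suc (suc zero)))) = (# 1) ∷ (# 5) ∷ []
Γc-blocks (suc (suc (suc (suc (suc zero))))) = (# 2) ∷ (# 3) ∷ []
Γc-blocks (suc (suc (suc (suc (suc (suc zero)))))) = (# 2) ∷ (# 6) ∷ []

Γc : Graph
Γc = record { V = Fin 7 ⊎ Fin 7 ; Adj = IncAdj (λ p b → p ∈ Γc-blocks b) }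

{-# OPTIONS --safe #-}
-- A triangle x y z of F gives the triangle a = xy, b = xz, c = yz of L(F). As F has no K₄ and no
-- induced diamond, two edges of a triangle of F determine its third vertex. As I(D) ≅ L(F′), the
-- intersection graph I(D) is claw-free, and the neighbours of an edge part pairwise meet (they
-- correspond to the edges at the non-leaf end of a pendant edge of F′). These facts force the part
-- through a and b to contain c, and some vertex of the triangle, say z, to have no further neighbour.
-- The other two parts through b are then edge parts {b, eᵢ} with spokes eᵢ at x, those through c
-- are {c, dᵢ} with spokes dᵢ at y, and the other two parts through a are {a, e₁, e₂} and
-- {a, d₁, d₂}. Each spoke lies in only these two parts, so it is a root and hence pendant; since F
-- is connected nothing else remains, and the seven edges and seven parts are incident exactly as
-- the points and blocks of Γc.

module Submission where

open import Axiom.UniquenessOfIdentityProofs using (module Decidable⇒UIP)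
open import Data.Bool using (Bool; true; false; T?)
import Data.Bool.Properties as Boolₚ
open import Data.Empty using (⊥; ⊥-elim)
open import Data.Fin as Fin using (Fin; zero; suc; _<_; #_)
import Data.Fin.Properties as Finₚ
open import Data.List using (List; []; _∷_; length; filterᵇ; allFin)
open import Data.List.Membership.Propositional using (_∈_)
open import Data.List.Membership.Propositional.Properties using (∈-filter⁺; ∈-allFin)
open import Data.List.Relation.Binary.Subset.DecPropositional (Fin._≟_ {7}) using (_⊆_; _⊆?_)
open import Data.List.Relation.Unary.All as All using (All; []; _∷_)
open import Data.List.Relation.Unary.Any as Any using (Any; here; there)
open import Data.Nat as ℕ using (ℕ; _≤_; s≤s)
import Data.Nat.Properties as ℕₚ
open import Data.Product using (Σ; ∃; ∃₂; _×_; _,_; proj₁; proj₂)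
open import Data.Sum as Sum using (_⊎_; inj₁; inj₂)
open import Data.Unit using (tt)
open import Data.Vec as Vec using ([]; _∷_)
open import Data.Vec.Relation.Unary.All using ([]; _∷_)
open import Data.Vec.Relation.Unary.AllPairs using ([]; _∷_)
open import Data.Vec.Relation.Unary.Unique.Propositional using (Unique)
open import Data.Vec.Relation.Unary.Unique.Propositional.Properties using (lookup-injective)
open import Function using (_∘_)
open import Function.Bundles using (Inverse; _↔_; _⇔_; mk⇔; mk↔ₛ′; Equivalence)
open import Function.Construct.Identity using (⇔-id)
open import Function.Construct.Symmetry using (↔-sym; ⇔-sym)
open import Relation.Binary using (tri<; tri≈; tri>)
open import Relation.Binary.Construct.Closure.ReflexiveTransitive using (Star; ε; _◅_)
open import Relation.Binary.PropositionalEquality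
open import Relation.Nullary using (¬_; Dec; yes; no; contradiction)
open import Relation.Nullary.Decidable using (_⊎-dec_; _×-dec_; _→-dec_; ¬?; ¬¬-excluded-middle; from-yes)
open import Defs

members-of-length-1 : ∀ {A : Set} {xs : List A} {s t : A} → length xs ≡ 1 → s ∈ xs → t ∈ xs → s ≡ t
members-of-length-1 {xs = _ ∷ []} _ (here refl) (here refl) = refl
members-of-length-1 {xs = _ ∷ []} _ (there ()) _
members-of-length-1 {xs = _ ∷ []} _ _ (there ())
members-of-length-1 {xs = _ ∷ _ ∷ _} () _ _

pigeonhole-pair : ∀ {A : Set} {a b c p q : A} → a ≢ b → a ≢ c → b ≢ c →
  a ≡ p ⊎ a ≡ q → b ≡ p ⊎ b ≡ q → c ≡ p ⊎ c ≡ q → ⊥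
pigeonhole-pair a≢b a≢c b≢c (inj₁ refl) (inj₁ refl) _ = a≢b refl
pigeonhole-pair a≢b a≢c b≢c (inj₂ refl) (inj₂ refl) _ = a≢b refl
pigeonhole-pair a≢b a≢c b≢c (inj₁ refl) (inj₂ refl) (inj₁ refl) = a≢c refl
pigeonhole-pair a≢b a≢c b≢c (inj₁ refl) (inj₂ refl) (inj₂ refl) = b≢c refl
pigeonhole-pair a≢b a≢c b≢c (inj₂ refl) (inj₁ refl) (inj₁ refl) = b≢c refl
pigeonhole-pair a≢b a≢c b≢c (inj₂ refl) (inj₁ refl) (inj₂ refl) = a≢c refl

Fin3-complement : (t : Fin 3) → ∃₂ λ s₁ s₂ →
  s₁ ≢ s₂ × s₁ ≢ t × s₂ ≢ t × (∀ s → s ≡ t ⊎ s ≡ s₁ ⊎ s ≡ s₂)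
Fin3-complement zero = suc zero , suc (suc zero) , (λ ()) , (λ ()) , (λ ()) ,
  λ { zero → inj₁ refl ; (suc zero) → inj₂ (inj₁ refl) ; (suc (suc zero)) → inj₂ (inj₂ refl) }
Fin3-complement (suc zero) = zero , suc (suc zero) , (λ ()) , (λ ()) , (λ ()) ,
  λ { zero → inj₂ (inj₁ refl) ; (suc zero) → inj₁ refl ; (suc (suc zero)) → inj₂ (inj₂ refl) }
Fin3-complement (suc (suc zero)) = zero , suc zero , (λ ()) , (λ ()) , (λ ()) ,
  λ { zero → inj₂ (inj₁ refl) ; (suc zero) → inj₂ (inj₂ refl) ; (suc (suc zero)) → inj₁ refl }

module _ {N : ℕ} {P : Fin N → Set} where

  exactly-1-unique : ExactlyN 1 P → ∀ {i j} → P i → P j → i ≡ j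
  exactly-1-unique (_ , _ , _ , cover) Pi Pj with cover _ Pi | cover _ Pj
  ... | zero , refl | zero , refl = refl

  exactly-2+-another : ∀ {k} → ExactlyN (ℕ.suc (ℕ.suc k)) P → ∀ i → ∃ λ j → j ≢ i × P j
  exactly-2+-another (f , f-inj , P-f , _) i with f zero Fin.≟ i
  ... | yes refl = f (suc zero) , (λ h → contradiction (f-inj _ _ h) λ ()) , P-f (suc zero)
  ... | no f0≢i = f zero , f0≢i , P-f zero

  exactly-3-not-within-two : ExactlyN 3 P → ∀ {i j} → ¬ (∀ l → P l → l ≡ i ⊎ l ≡ j)
  exactly-3-not-within-two (f , f-inj , P-f , _) within =
    pigeonhole-pair (λ h → contradiction (f-inj zero (suc zero) h) λ ())
                    (λ h → contradiction (f-inj zero (suc (suc zero)) h) λ ())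
                    (λ h → contradiction (f-inj (suc zero) (suc (suc zero)) h) λ ())
                    (within _ (P-f zero)) (within _ (P-f (suc zero))) (within _ (P-f (suc (suc zero))))

  record TwoOthers (i : Fin N) : Set where
    field
      j₁ j₂ : Fin N
      j₁≢j₂ : j₁ ≢ j₂
      j₁≢i : j₁ ≢ i
      j₂≢i : j₂ ≢ i
      P-j₁ : P j₁
      P-j₂ : P j₂
      only : ∀ l → P l → l ≡ i ⊎ l ≡ j₁ ⊎ l ≡ j₂

  exactly-3-others : ExactlyN 3 P → ∀ {i} → P i → TwoOthers i
  exactly-3-others (f , f-inj , P-f , cover) Pi with cover _ Pi
  ... | t , refl with Fin3-complement t
  ... | s₁ , s₂ , s₁≢s₂ , s₁≢t , s₂≢t , cover-Fin3 = record
    { j₁ = f s₁ ; j₂ = f s₂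
    ; j₁≢j₂ = s₁≢s₂ ∘ f-inj _ _ ; j₁≢i = s₁≢t ∘ f-inj _ _ ; j₂≢i = s₂≢t ∘ f-inj _ _
    ; P-j₁ = P-f s₁ ; P-j₂ = P-f s₂
    ; only = only }
    where
    only : ∀ l → P l → l ≡ f t ⊎ l ≡ f s₁ ⊎ l ≡ f s₂
    only l Pl with cover l Pl
    ... | s , refl with cover-Fin3 s
    ... | inj₁ refl = inj₁ refl
    ... | inj₂ (inj₁ refl) = inj₂ (inj₁ refl)
    ... | inj₂ (inj₂ refl) = inj₂ (inj₂ refl)

  TwoOthers-swap : ∀ {i} → TwoOthers i → TwoOthers i
  TwoOthers-swap o = record
    { j₁ = j₂ ; j₂ = j₁ ; j₁≢j₂ = j₁≢j₂ ∘ sym ; j₁≢i = j₂≢i ; j₂≢i = j₁≢i ; P-j₁ = P-j₂ ; P-j₂ = P-j₁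
    ; only = λ l Pl → Sum.map₂ Sum.swap (only l Pl) }
    where
    open TwoOthers o

module FinGraphProperties (G : FinGraph) where

  private
    Vertex : Set
    Vertex = Fin (n G)

  infix 4 _∼_ _∈ᵉ_

  _∼_ : Vertex → Vertex → Set
  p ∼ q = adj G p q ≡ true

  _∈ᵉ_ : Vertex → Edge G → Set
  w ∈ᵉ e = IsEndpoint G w e

  ∼-sym : ∀ {p q} → p ∼ q → q ∼ p
  ∼-sym {p} {q} h = trans (adj-sym G q p) h

  ∼⇒≢ : ∀ {p q} → p ∼ q → p ≢ q
  ∼⇒≢ {p} h refl with trans (sym h) (adj-irrefl G p)
  ... | ()

  degree≡1⇒neighbour-unique : ∀ {v s t} → degree G v ≡ 1 → v ∼ s → v ∼ t → s ≡ t
  degree≡1⇒neighbour-unique {v} d vs vt =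
    members-of-length-1 d (neighbour∈filter vs) (neighbour∈filter vt)
    where
    neighbour∈filter : ∀ {s} → v ∼ s → s ∈ filterᵇ (adj G v) (allFin (n G))
    neighbour∈filter {s} h = ∈-filter⁺ (T? ∘ adj G v) (∈-allFin s) (Equivalence.from Boolₚ.T-≡ h)

  two-neighbours⇒degree≢1 : ∀ {v s t} → s ≢ t → v ∼ s → v ∼ t → degree G v ≢ 1
  two-neighbours⇒degree≢1 s≢t vs vt d = s≢t (degree≡1⇒neighbour-unique d vs vt)

  connected-closed⇒all : Connected G → ∀ {S : Vertex → Set} {v₀} → S v₀ →
    (∀ {u v} → S u → u ∼ v → S v) → ∀ v → S v
  connected-closed⇒all connected {S} {v₀} S-v₀ closed v = reach (connected v₀ v) S-v₀
    where
    reach : ∀ {u v} → Star _∼_ u v → S u → S v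
    reach ε S-u = S-u
    reach (uw ◅ path) S-u = reach path (closed S-u uw)

  lower upper : Edge G → Vertex
  lower e = proj₁ (proj₁ e)
  upper e = proj₂ (proj₁ e)

  lower<upper : ∀ e → lower e < upper e
  lower<upper e = proj₁ (proj₂ e)

  lower≢upper : ∀ e → lower e ≢ upper e
  lower≢upper e eq = ℕₚ.<-irrefl (cong Fin.toℕ eq) (lower<upper e)

  edge-≡ : ∀ e f → lower e ≡ lower f → upper e ≡ upper f → e ≡ f
  edge-≡ ((u , v) , lt , uv) ((.u , .v) , lt′ , uv′) refl refl
    rewrite Finₚ.<-irrelevant lt lt′ | Decidable⇒UIP.≡-irrelevant Boolₚ._≟_ uv uv′ = refl

  _≟ᵉ_ : (e f : Edge G) → Dec (e ≡ f)
  e ≟ᵉ f with lower e Fin.≟ lower f | upper e Fin.≟ upper f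
  ... | yes l | yes u = yes (edge-≡ e f l u)
  ... | no l≢ | _ = no λ h → l≢ (cong lower h)
  ... | _ | no u≢ = no λ h → u≢ (cong upper h)

  record Joins (e : Edge G) (p q : Vertex) : Set where
    constructor joins
    field
      end₁ : p ∈ᵉ e
      end₂ : q ∈ᵉ e
  open Joins public

  joins-sym : ∀ {e p q} → Joins e p q → Joins e q p
  joins-sym (joins p∈e q∈e) = joins q∈e p∈e

  joins-endpoint : ∀ {e p q w} → Joins e p q → p ≢ q → w ∈ᵉ e → w ≡ p ⊎ w ≡ q
  joins-endpoint (joins (inj₁ a) (inj₁ b)) p≢q _ = ⊥-elim (p≢q (trans a (sym b)))
  joins-endpoint (joins (inj₂ a) (inj₂ b)) p≢q _ = ⊥-elim (p≢q (trans a (sym b)))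
  joins-endpoint (joins (inj₁ a) (inj₂ b)) _ (inj₁ c) = inj₁ (trans c (sym a))
  joins-endpoint (joins (inj₁ a) (inj₂ b)) _ (inj₂ c) = inj₂ (trans c (sym b))
  joins-endpoint (joins (inj₂ a) (inj₁ b)) _ (inj₁ c) = inj₂ (trans c (sym b))
  joins-endpoint (joins (inj₂ a) (inj₁ b)) _ (inj₂ c) = inj₁ (trans c (sym a))

  joins-unique : ∀ {p q} e f → p ≢ q → Joins e p q → Joins f p q → e ≡ f
  joins-unique e f p≢q (joins (inj₁ a) (inj₁ b)) _ = ⊥-elim (p≢q (trans a (sym b)))
  joins-unique e f p≢q (joins (inj₂ a) (inj₂ b)) _ = ⊥-elim (p≢q (trans a (sym b)))
  joins-unique e f p≢q _ (joins (inj₁ a) (inj₁ b)) = ⊥-elim (p≢q (trans a (sym b)))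
  joins-unique e f p≢q _ (joins (inj₂ a) (inj₂ b)) = ⊥-elim (p≢q (trans a (sym b)))
  joins-unique e f _ (joins (inj₁ a) (inj₂ b)) (joins (inj₁ c) (inj₂ d)) = edge-≡ e f (trans (sym a) c) (trans (sym b) d)
  joins-unique e f _ (joins (inj₂ a) (inj₁ b)) (joins (inj₂ c) (inj₁ d)) = edge-≡ e f (trans (sym b) d) (trans (sym a) c)
  joins-unique e f _ (joins (inj₁ a) (inj₂ b)) (joins (inj₂ c) (inj₁ d)) = ⊥-elim (ℕₚ.<-asym (lower<upper e)
    (subst₂ (λ u v → Fin.toℕ u ℕ.< Fin.toℕ v) (trans (sym d) b) (trans (sym c) a) (lower<upper f)))
  joins-unique e f _ (joins (inj₂ a) (inj₁ b)) (joins (inj₁ c) (inj₂ d)) = ⊥-elim (ℕₚ.<-asym (lower<upper e)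
    (subst₂ (λ u v → Fin.toℕ u ℕ.< Fin.toℕ v) (trans (sym c) a) (trans (sym d) b) (lower<upper f)))

  joins⇒∼ : ∀ {e p q} → Joins e p q → p ≢ q → p ∼ q
  joins⇒∼ (joins (inj₁ refl) (inj₁ refl)) p≢q = ⊥-elim (p≢q refl)
  joins⇒∼ (joins (inj₂ refl) (inj₂ refl)) p≢q = ⊥-elim (p≢q refl)
  joins⇒∼ {e} (joins (inj₁ refl) (inj₂ refl)) _ = proj₂ (proj₂ e)
  joins⇒∼ {e} (joins (inj₂ refl) (inj₁ refl)) _ = ∼-sym (proj₂ (proj₂ e))

  edge-joining : ∀ {p q} → p ∼ q → ∃ λ e → Joins e p q
  edge-joining {p} {q} p∼q with Finₚ.<-cmp p q
  ... | tri< p<q _ _ = ((p , q) , p<q , p∼q) , joins (inj₁ refl) (inj₂ refl)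
  ... | tri≈ _ refl _ = ⊥-elim (∼⇒≢ p∼q refl)
  ... | tri> _ _ q<p = ((q , p) , q<p , ∼-sym p∼q) , joins (inj₂ refl) (inj₁ refl)

  joins-ends : ∀ e → Joins e (lower e) (upper e)
  joins-ends e = joins (inj₁ refl) (inj₂ refl)

  other-end : ∀ {e w} → w ∈ᵉ e → ∃ λ q → Joins e w q × w ≢ q
  other-end {e} (inj₁ refl) = upper e , joins (inj₁ refl) (inj₂ refl) , lower≢upper e
  other-end {e} (inj₂ refl) = lower e , joins (inj₂ refl) (inj₁ refl) , lower≢upper e ∘ sym

  outside-endpoint⇒≢ : ∀ {e f p r s} → p ∈ᵉ e → Joins f r s → r ≢ s → p ≢ r → p ≢ s → e ≢ f
  outside-endpoint⇒≢ p∈e f-rs r≢s p≢r p≢s refl with joins-endpoint f-rs r≢s p∈e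
  ... | inj₁ p≡r = p≢r p≡r
  ... | inj₂ p≡s = p≢s p≡s

module _ {G H : Graph} where

  Iso-injective : (φ : Iso G H) → ∀ {x y} → Inverse.to (proj₁ φ) x ≡ Inverse.to (proj₁ φ) y → x ≡ y
  Iso-injective (φ , _) {x} {y} eq = begin
    x                  ≡⟨ sym (strictlyInverseʳ x) ⟩
    from (to x)        ≡⟨ cong from eq ⟩
    from (to y)        ≡⟨ strictlyInverseʳ y ⟩
    y                  ∎
    where
    open Inverse φ
    open ≡-Reasoning

  Iso-sym : Iso G H → Iso H G
  Iso-sym (φ , adj⇔) = ↔-sym φ , λ u v →
    subst₂ (λ u′ v′ → Adj H u′ v′ ⇔ Adj G (from u) (from v))
           (strictlyInverseˡ u) (strictlyInverseˡ v) (⇔-sym (adj⇔ (from u) (from v)))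
    where
    open Inverse φ

-- Incidence graphs isomorphic to Γc

IncidenceGraph : {P B : Set} → (P → B → Set) → Graph
IncidenceGraph {P} {B} _∈′_ = record { V = P ⊎ B ; Adj = IncAdj _∈′_ }

enumeration-↔ : ∀ {m} {A : Set} (t : Fin m → A) → (∀ i j → t i ≡ t j → i ≡ j) →
  (∀ a → ∃ λ i → t i ≡ a) → Fin m ↔ A
enumeration-↔ t injective surjective =
  mk↔ₛ′ t (proj₁ ∘ surjective) (proj₂ ∘ surjective) (λ i → injective _ _ (proj₂ (surjective (t i))))

incidence-iso : {P B P′ B′ : Set} {_∈₁_ : P → B → Set} {_∈₂_ : P′ → B′ → Set} →
  (f : P ↔ P′) (g : B ↔ B′) → (∀ p b → p ∈₁ b ⇔ Inverse.to f p ∈₂ Inverse.to g b) →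
  Iso (IncidenceGraph _∈₁_) (IncidenceGraph _∈₂_)
incidence-iso {P} {B} {P′} {B′} {_∈₁_} {_∈₂_} f g mem = points⊎blocks , adjacency
  where
  module f = Inverse f
  module g = Inverse g
  points⊎blocks : (P ⊎ B) ↔ (P′ ⊎ B′)
  points⊎blocks = mk↔ₛ′ (Sum.map f.to g.to) (Sum.map f.from g.from)
    (λ { (inj₁ p) → cong inj₁ (f.strictlyInverseˡ p) ; (inj₂ b) → cong inj₂ (g.strictlyInverseˡ b) })
    (λ { (inj₁ p) → cong inj₁ (f.strictlyInverseʳ p) ; (inj₂ b) → cong inj₂ (g.strictlyInverseʳ b) })
  adjacency : ∀ u v → IncAdj _∈₁_ u v ⇔ IncAdj _∈₂_ (Sum.map f.to g.to u) (Sum.map f.to g.to v)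
  adjacency (inj₁ p) (inj₁ q) = ⇔-id ⊥
  adjacency (inj₁ p) (inj₂ b) = mem p b
  adjacency (inj₂ b) (inj₁ p) = mem p b
  adjacency (inj₂ b) (inj₂ c) = ⇔-id ⊥

Γc-blocks-incomparable : ∀ q q′ → Γc-blocks q ⊆ Γc-blocks q′ → q ≡ q′
Γc-blocks-incomparable = from-yes
  (Finₚ.all? λ q → Finₚ.all? λ q′ → (Γc-blocks q ⊆? Γc-blocks q′) →-dec (q Fin.≟ q′))

module _ {Pt Bl : Set} {_∈′_ : Pt → Bl → Set} (point : Fin 7 → Pt) (block : Fin 7 → Bl)
         (point-injective : ∀ i j → point i ≡ point j → i ≡ j)
         (point-surjective : ∀ p → ∃ λ i → point i ≡ p)
         (block-surjective : ∀ b → ∃ λ j → block j ≡ b)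
         (incidences : ∀ j → All (λ i → point i ∈′ block j) (Γc-blocks j))
         (contents : ∀ j {p} → p ∈′ block j → Any (λ i → point i ≡ p) (Γc-blocks j)) where

  Γc-incidence : ∀ i j → i ∈ Γc-blocks j ⇔ point i ∈′ block j
  Γc-incidence i j = mk⇔ (All.lookup (incidences j))
    (Any.map (λ eq → point-injective _ _ (sym eq)) ∘ contents j)

  block-injective : ∀ j j′ → block j ≡ block j′ → j ≡ j′
  block-injective j j′ eq = Γc-blocks-incomparable j j′ λ {i} i∈j →
    Equivalence.from (Γc-incidence i j′) (subst (point i ∈′_) eq (Equivalence.to (Γc-incidence i j) i∈j))

  Γc-labelling⇒iso : Iso (IncidenceGraph _∈′_) Γc
  Γc-labelling⇒iso = Iso-sym (incidence-iso
    (enumeration-↔ point point-injective point-surjective)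
    (enumeration-↔ block block-injective block-surjective) Γc-incidence)

-- Intersection graphs of decompositions

module _ {Γ : Graph} {R : V Γ → Set} (D : ValidDecomposition Γ R) where

  Meet : Fin (k D) → Fin (k D) → Set
  Meet i j = ∃ λ x → (x ∈P part D i) × (x ∈P part D j)

  ClawFree : Set
  ClawFree = ∀ i j₁ j₂ j₃ → j₁ ≢ j₂ → j₁ ≢ j₃ → j₂ ≢ j₃ → i ≢ j₁ → i ≢ j₂ → i ≢ j₃ →
    Meet i j₁ → Meet i j₂ → Meet i j₃ → Meet j₁ j₂ ⊎ Meet j₁ j₃ ⊎ Meet j₂ j₃

  EdgePartsSimplicial : Set
  EdgePartsSimplicial = ∀ i j₁ j₂ → IsEdgePart (part D i) → j₁ ≢ j₂ → i ≢ j₁ → i ≢ j₂ →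
    Meet i j₁ → Meet i j₂ → Meet j₁ j₂

  module _ (F′ : FinGraph) (φ : Iso (IGraph D) (LineGraph F′))
           (pendant : ∀ i → IsEdgePart (part D i) → Pendant F′ (Inverse.to (proj₁ φ) i)) where

    open FinGraphProperties F′

    private
      to : Fin (k D) → Edge F′
      to = Inverse.to (proj₁ φ)

      meet⇒ladj : ∀ {i j} → i ≢ j → Meet i j → LAdj F′ (to i) (to j)
      meet⇒ladj {i} {j} i≢j m = Equivalence.to (proj₂ φ i j) (i≢j , m)

      common-end⇒meet : ∀ {i j w} → i ≢ j → w ∈ᵉ to i → w ∈ᵉ to j → Meet i j
      common-end⇒meet {i} {j} {w} i≢j w∈i w∈j =
        proj₂ (Equivalence.from (proj₂ φ i j) (i≢j ∘ Iso-injective {H = LineGraph F′} φ , w , w∈i , w∈j))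

      neighbours-share-other-end : ∀ {i j u v} → Joins (to i) u v → u ≢ v → degree F′ u ≡ 1 →
        i ≢ j → Meet i j → v ∈ᵉ to j
      neighbours-share-other-end {i} {j} {u} {v} uv u≢v deg i≢j m with meet⇒ladj i≢j m
      ... | to-i≢to-j , w , w∈i , w∈j with joins-endpoint uv u≢v w∈i
      ... | inj₂ refl = w∈j
      ... | inj₁ refl with other-end w∈j
      ... | r , wr , w≢r with degree≡1⇒neighbour-unique deg (joins⇒∼ wr w≢r) (joins⇒∼ uv u≢v)
      ... | refl = ⊥-elim (to-i≢to-j (joins-unique (to i) (to j) u≢v uv wr))

    line-graph⇒claw-free : ClawFree
    line-graph⇒claw-free i j₁ j₂ j₃ j₁≢j₂ j₁≢j₃ j₂≢j₃ i≢j₁ i≢j₂ i≢j₃ m₁ m₂ m₃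
      with meet⇒ladj i≢j₁ m₁ | meet⇒ladj i≢j₂ m₂ | meet⇒ladj i≢j₃ m₃
    ... | _ , _ , p₁ , q₁ | _ , _ , p₂ , q₂ | _ , _ , p₃ , q₃ with p₁ | p₂ | p₃
    ... | inj₁ refl | inj₁ refl | _ = inj₁ (common-end⇒meet j₁≢j₂ q₁ q₂)
    ... | inj₂ refl | inj₂ refl | _ = inj₁ (common-end⇒meet j₁≢j₂ q₁ q₂)
    ... | inj₁ refl | inj₂ refl | inj₁ refl = inj₂ (inj₁ (common-end⇒meet j₁≢j₃ q₁ q₃))
    ... | inj₁ refl | inj₂ refl | inj₂ refl = inj₂ (inj₂ (common-end⇒meet j₂≢j₃ q₂ q₃))
    ... | inj₂ refl | inj₁ refl | inj₁ refl = inj₂ (inj₂ (common-end⇒meet j₂≢j₃ q₂ q₃))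
    ... | inj₂ refl | inj₁ refl | inj₂ refl = inj₂ (inj₁ (common-end⇒meet j₁≢j₃ q₁ q₃))

    pendant⇒edge-parts-simplicial : EdgePartsSimplicial
    pendant⇒edge-parts-simplicial i j₁ j₂ edge-part j₁≢j₂ i≢j₁ i≢j₂ m₁ m₂ with pendant i edge-part
    ... | inj₁ deg = common-end⇒meet j₁≢j₂
      (neighbours-share-other-end (joins-ends (to i)) (lower≢upper (to i)) deg i≢j₁ m₁)
      (neighbours-share-other-end (joins-ends (to i)) (lower≢upper (to i)) deg i≢j₂ m₂)
    ... | inj₂ deg = common-end⇒meet j₁≢j₂
      (neighbours-share-other-end (joins-sym (joins-ends (to i))) (lower≢upper (to i) ∘ sym) deg i≢j₁ m₁)
      (neighbours-share-other-end (joins-sym (joins-ends (to i))) (lower≢upper (to i) ∘ sym) deg i≢j₂ m₂)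

-- Two triangles sharing an edge span a K₄ or an induced diamond

module _ (G : FinGraph) where

  open FinGraphProperties G

  private
    Vertex : Set
    Vertex = Fin (n G)

  quadruple : Vertex → Vertex → Vertex → Vertex → Fin 4 → Vertex
  quadruple a b c d zero = a
  quadruple a b c d (suc zero) = b
  quadruple a b c d (suc (suc zero)) = c
  quadruple a b c d (suc (suc (suc zero))) = d

  quadruple-injective : ∀ {a b c d} → a ≢ b → a ≢ c → a ≢ d → b ≢ c → b ≢ d → c ≢ d →
    ∀ i j → quadruple a b c d i ≡ quadruple a b c d j → i ≡ j
  quadruple-injective ab ac ad bc bd cd = λ where
    zero zero _ → refl
    zero (suc zero) h → ⊥-elim (ab h)
    zero (suc (suc zero)) h → ⊥-elim (ac h)
    zero (suc (suc (suc zero))) h → ⊥-elim (ad h)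
    (suc zero) zero h → ⊥-elim (ab (sym h))
    (suc zero) (suc zero) _ → refl
    (suc zero) (suc (suc zero)) h → ⊥-elim (bc h)
    (suc zero) (suc (suc (suc zero))) h → ⊥-elim (bd h)
    (suc (suc zero)) zero h → ⊥-elim (ac (sym h))
    (suc (suc zero)) (suc zero) h → ⊥-elim (bc (sym h))
    (suc (suc zero)) (suc (suc zero)) _ → refl
    (suc (suc zero)) (suc (suc (suc zero))) h → ⊥-elim (cd h)
    (suc (suc (suc zero))) zero h → ⊥-elim (ad (sym h))
    (suc (suc (suc zero))) (suc zero) h → ⊥-elim (bd (sym h))
    (suc (suc (suc zero))) (suc (suc zero)) h → ⊥-elim (cd (sym h))
    (suc (suc (suc zero))) (suc (suc (suc zero))) _ → refl

  nearlyComplete : Bool → Fin 4 → Fin 4 → Bool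
  nearlyComplete v (suc (suc zero)) (suc (suc (suc zero))) = v
  nearlyComplete v (suc (suc (suc zero))) (suc (suc zero)) = v
  nearlyComplete v i j = diamondAdj i j

  nearlyComplete-false : ∀ i j → nearlyComplete false i j ≡ diamondAdj i j
  nearlyComplete-false (suc (suc zero)) (suc (suc (suc zero))) = refl
  nearlyComplete-false (suc (suc (suc zero))) (suc (suc zero)) = refl
  nearlyComplete-false zero _ = refl
  nearlyComplete-false (suc zero) _ = refl
  nearlyComplete-false (suc (suc zero)) zero = refl
  nearlyComplete-false (suc (suc zero)) (suc zero) = refl
  nearlyComplete-false (suc (suc zero)) (suc (suc zero)) = refl
  nearlyComplete-false (suc (suc (suc zero))) zero = refl
  nearlyComplete-false (suc (suc (suc zero))) (suc zero) = refl
  nearlyComplete-false (suc (suc (suc zero))) (suc (suc (suc zero))) = refl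

  nearlyComplete-true : ∀ i j → i ≢ j → nearlyComplete true i j ≡ true
  nearlyComplete-true = λ where
    zero zero i≢j → ⊥-elim (i≢j refl)
    zero (suc zero) _ → refl
    zero (suc (suc zero)) _ → refl
    zero (suc (suc (suc zero))) _ → refl
    (suc zero) zero _ → refl
    (suc zero) (suc zero) i≢j → ⊥-elim (i≢j refl)
    (suc zero) (suc (suc zero)) _ → refl
    (suc zero) (suc (suc (suc zero))) _ → refl
    (suc (suc zero)) zero _ → refl
    (suc (suc zero)) (suc zero) _ → refl
    (suc (suc zero)) (suc (suc zero)) i≢j → ⊥-elim (i≢j refl)
    (suc (suc zero)) (suc (suc (suc zero))) _ → refl
    (suc (suc (suc zero))) zero _ → refl
    (suc (suc (suc zero))) (suc zero) _ → refl
    (suc (suc (suc zero))) (suc (suc zero)) _ → refl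
    (suc (suc (suc zero))) (suc (suc (suc zero))) i≢j → ⊥-elim (i≢j refl)

  quadruple-adj : ∀ {a b c d} → a ∼ b → a ∼ c → a ∼ d → b ∼ c → b ∼ d → ∀ v → adj G c d ≡ v →
    ∀ i j → adj G (quadruple a b c d i) (quadruple a b c d j) ≡ nearlyComplete v i j
  quadruple-adj {a} {b} {c} {d} ab ac ad bc bd v cd = λ where
    zero zero → adj-irrefl G a
    zero (suc zero) → ab
    zero (suc (suc zero)) → ac
    zero (suc (suc (suc zero))) → ad
    (suc zero) zero → ∼-sym ab
    (suc zero) (suc zero) → adj-irrefl G b
    (suc zero) (suc (suc zero)) → bc
    (suc zero) (suc (suc (suc zero))) → bd
    (suc (suc zero)) zero → ∼-sym ac
    (suc (suc zero)) (suc zero) → ∼-sym bc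
    (suc (suc zero)) (suc (suc zero)) → adj-irrefl G c
    (suc (suc zero)) (suc (suc (suc zero))) → cd
    (suc (suc (suc zero))) zero → ∼-sym ad
    (suc (suc (suc zero))) (suc zero) → ∼-sym bd
    (suc (suc (suc zero))) (suc (suc zero)) → trans (adj-sym G d c) cd
    (suc (suc (suc zero))) (suc (suc (suc zero))) → adj-irrefl G d

  quadruple-clique : ∀ {x y z s} → x ∼ y → x ∼ z → y ∼ z → x ∼ s → y ∼ s → z ∼ s → Clique G 4
  quadruple-clique {x} {y} {z} {s} xy xz yz xs ys zs =
    quadruple x y z s ,
    quadruple-injective (∼⇒≢ xy) (∼⇒≢ xz) (∼⇒≢ xs) (∼⇒≢ yz) (∼⇒≢ ys) (∼⇒≢ zs) ,
    λ i j i≢j → trans (quadruple-adj xy xz xs yz ys true zs i j) (nearlyComplete-true i j i≢j)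

  quadruple-diamond : ∀ {x y z s} → x ∼ y → x ∼ z → y ∼ z → x ∼ s → y ∼ s → z ≢ s → adj G z s ≡ false →
    InducedSub diamond G
  quadruple-diamond {x} {y} {z} {s} xy xz yz xs ys z≢s zs =
    quadruple x y z s ,
    quadruple-injective (∼⇒≢ xy) (∼⇒≢ xz) (∼⇒≢ xs) (∼⇒≢ yz) (∼⇒≢ ys) z≢s ,
    λ i j → trans (quadruple-adj xy xz xs yz ys false zs i j) (nearlyComplete-false i j)

  triangle-apex-unique : (∀ s → Clique G s → s ≤ 3) → ¬ InducedSub diamond G →
    ∀ {x y z s} → x ∼ y → x ∼ z → y ∼ z → x ∼ s → y ∼ s → z ≡ s
  triangle-apex-unique K₄-free diamond-free {z = z} {s} xy xz yz xs ys with z Fin.≟ s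
  ... | yes z≡s = z≡s
  ... | no z≢s with adj G z s in zs
  ... | true = contradiction (K₄-free 4 (quadruple-clique xy xz yz xs ys zs)) λ { (s≤s (s≤s (s≤s ()))) }
  ... | false = ⊥-elim (diamond-free (quadruple-diamond xy xz yz xs ys z≢s zs))

module LineGraphDecomposition (F : FinGraph) {R : Edge F → Set} (D : ValidDecomposition (LineGraph F) R) where

  open FinGraphProperties F

  private
    Part′ : Set
    Part′ = Fin (k D)

  infix 4 _∈ₚ_ _∈ₚ?_

  _∈ₚ_ : Edge F → Part′ → Set
  e ∈ₚ i = e ∈P part D i

  _∈ₚ?_ : ∀ e i → Dec (e ∈ₚ i)
  e ∈ₚ? i with part D i
  ... | tri a b c = (e ≟ᵉ a) ⊎-dec (e ≟ᵉ b) ⊎-dec (e ≟ᵉ c)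
  ... | edg a b = (e ≟ᵉ a) ⊎-dec (e ≟ᵉ b)

  some-member : ∀ i → ∃ λ e → e ∈ₚ i
  some-member i with part D i
  ... | tri p _ _ = p , inj₁ refl
  ... | edg p _ = p , inj₁ refl

  LAdj-sym : ∀ {e f} → LAdj F e f → LAdj F f e
  LAdj-sym (e≢f , w , w∈e , w∈f) = e≢f ∘ sym , w , w∈f , w∈e

  co-members-adjacent : ∀ {e f i} → e ∈ₚ i → f ∈ₚ i → e ≢ f → LAdj F e f
  co-members-adjacent {e} {f} {i} e∈i f∈i e≢f with part D i | valid D i
  ... | tri a b c | ab , bc , ac = adjacent e∈i f∈i
    where
    adjacent : e ∈P tri a b c → f ∈P tri a b c → LAdj F e f
    adjacent (inj₁ refl) (inj₁ refl) = ⊥-elim (e≢f refl)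
    adjacent (inj₁ refl) (inj₂ (inj₁ refl)) = ab
    adjacent (inj₁ refl) (inj₂ (inj₂ refl)) = ac
    adjacent (inj₂ (inj₁ refl)) (inj₁ refl) = LAdj-sym ab
    adjacent (inj₂ (inj₁ refl)) (inj₂ (inj₁ refl)) = ⊥-elim (e≢f refl)
    adjacent (inj₂ (inj₁ refl)) (inj₂ (inj₂ refl)) = bc
    adjacent (inj₂ (inj₂ refl)) (inj₁ refl) = LAdj-sym ac
    adjacent (inj₂ (inj₂ refl)) (inj₂ (inj₁ refl)) = LAdj-sym bc
    adjacent (inj₂ (inj₂ refl)) (inj₂ (inj₂ refl)) = ⊥-elim (e≢f refl)
  ... | edg a b | ab = adjacent e∈i f∈i
    where
    adjacent : e ∈P edg a b → f ∈P edg a b → LAdj F e f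
    adjacent (inj₁ refl) (inj₁ refl) = ⊥-elim (e≢f refl)
    adjacent (inj₁ refl) (inj₂ refl) = ab
    adjacent (inj₂ refl) (inj₁ refl) = LAdj-sym ab
    adjacent (inj₂ refl) (inj₂ refl) = ⊥-elim (e≢f refl)

  common-part : ∀ {e f} → LAdj F e f → ∃ λ i → e ∈ₚ i × f ∈ₚ i
  common-part {e} {f} ef with partition D e f ef
  ... | choose , _ , both , _ = choose zero , both zero

  common-part-unique : ∀ {e f i j} → e ≢ f → e ∈ₚ i → f ∈ₚ i → e ∈ₚ j → f ∈ₚ j → i ≡ j
  common-part-unique {e} {f} e≢f e∈i f∈i e∈j f∈j =
    exactly-1-unique (partition D e f (co-members-adjacent e∈i f∈i e≢f)) (e∈i , f∈i) (e∈j , f∈j)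

  another-member : ∀ {e i} → e ∈ₚ i → ∃ λ f → f ∈ₚ i × f ≢ e
  another-member {e} {i} e∈i with part D i | valid D i
  ... | tri p q r | (p≢q , _) , _ = other e∈i
    where
    other : e ∈P tri p q r → ∃ λ f → f ∈P tri p q r × f ≢ e
    other (inj₁ refl) = q , inj₂ (inj₁ refl) , p≢q ∘ sym
    other (inj₂ _) with e ≟ᵉ p
    ... | yes refl = q , inj₂ (inj₁ refl) , p≢q ∘ sym
    ... | no e≢p = p , inj₁ refl , e≢p ∘ sym
  ... | edg p q | p≢q , _ = other e∈i
    where
    other : e ∈P edg p q → ∃ λ f → f ∈P edg p q × f ≢ e
    other (inj₁ refl) = q , inj₂ refl , p≢q ∘ sym
    other (inj₂ refl) = p , inj₁ refl , p≢q

  third-member : ∀ {e f i} → ¬ IsEdgePart (part D i) → e ∈ₚ i → f ∈ₚ i → e ≢ f →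
    ∃ λ g → g ∈ₚ i × g ≢ e × g ≢ f
  third-member {e} {f} {i} not-edge _ _ e≢f with part D i | valid D i
  ... | edg _ _ | _ = ⊥-elim (not-edge tt)
  ... | tri p q r | (p≢q , _) , (q≢r , _) , (p≢r , _) with p ≟ᵉ e | p ≟ᵉ f
  ... | no p≢e | no p≢f = p , inj₁ refl , p≢e , p≢f
  ... | yes refl | _ with q ≟ᵉ f
  ...   | no q≢f = q , inj₂ (inj₁ refl) , p≢q ∘ sym , q≢f
  ...   | yes refl = r , inj₂ (inj₂ refl) , p≢r ∘ sym , q≢r ∘ sym
  third-member {e} {f} {i} _ _ _ e≢f | tri p q r | (p≢q , _) , (q≢r , _) , (p≢r , _) | no _ | yes refl
    with q ≟ᵉ e
  ...   | no q≢e = q , inj₂ (inj₁ refl) , q≢e , p≢q ∘ sym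
  ...   | yes refl = r , inj₂ (inj₂ refl) , q≢r ∘ sym , p≢r ∘ sym

  members-of-triple : ∀ {a b c} i → a ≢ b → a ≢ c → b ≢ c → a ∈ₚ i → b ∈ₚ i → c ∈ₚ i →
    ∀ e → e ∈ₚ i → e ≡ a ⊎ e ≡ b ⊎ e ≡ c
  members-of-triple {a} {b} {c} i a≢b a≢c b≢c a∈i b∈i c∈i e e∈i with e ≟ᵉ a | e ≟ᵉ b | e ≟ᵉ c
  ... | yes e≡a | _ | _ = inj₁ e≡a
  ... | no _ | yes e≡b | _ = inj₂ (inj₁ e≡b)
  ... | no _ | no _ | yes e≡c = inj₂ (inj₂ e≡c)
  ... | no e≢a | no e≢b | no e≢c with part D i
  ... | edg p q = ⊥-elim (pigeonhole-pair a≢b a≢c b≢c a∈i b∈i c∈i)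
  ... | tri p q r = ⊥-elim (remaining-two e∈i a∈i b∈i c∈i)
    where
    without-p : ∀ {u} → u ∈P tri p q r → u ≢ p → u ≡ q ⊎ u ≡ r
    without-p (inj₁ u≡p) u≢p = ⊥-elim (u≢p u≡p)
    without-p (inj₂ u∈qr) _ = u∈qr
    without-q : ∀ {u} → u ∈P tri p q r → u ≢ q → u ≡ p ⊎ u ≡ r
    without-q (inj₁ u≡p) _ = inj₁ u≡p
    without-q (inj₂ (inj₁ u≡q)) u≢q = ⊥-elim (u≢q u≡q)
    without-q (inj₂ (inj₂ u≡r)) _ = inj₂ u≡r
    without-r : ∀ {u} → u ∈P tri p q r → u ≢ r → u ≡ p ⊎ u ≡ q
    without-r (inj₁ u≡p) _ = inj₁ u≡p
    without-r (inj₂ (inj₁ u≡q)) _ = inj₂ u≡q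
    without-r (inj₂ (inj₂ u≡r)) u≢r = ⊥-elim (u≢r u≡r)
    remaining-two : e ∈P tri p q r → a ∈P tri p q r → b ∈P tri p q r → c ∈P tri p q r → ⊥
    remaining-two (inj₁ refl) a∈ b∈ c∈ = pigeonhole-pair a≢b a≢c b≢c
      (without-p a∈ (e≢a ∘ sym)) (without-p b∈ (e≢b ∘ sym)) (without-p c∈ (e≢c ∘ sym))
    remaining-two (inj₂ (inj₁ refl)) a∈ b∈ c∈ = pigeonhole-pair a≢b a≢c b≢c
      (without-q a∈ (e≢a ∘ sym)) (without-q b∈ (e≢b ∘ sym)) (without-q c∈ (e≢c ∘ sym))
    remaining-two (inj₂ (inj₂ refl)) a∈ b∈ c∈ = pigeonhole-pair a≢b a≢c b≢c
      (without-r a∈ (e≢a ∘ sym)) (without-r b∈ (e≢b ∘ sym)) (without-r c∈ (e≢c ∘ sym))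

  pair-part⇒edge-part : ∀ {p q} i → (∀ e → e ∈ₚ i → e ≡ p ⊎ e ≡ q) → IsEdgePart (part D i)
  pair-part⇒edge-part i within with part D i | valid D i
  ... | edg _ _ | _ = tt
  ... | tri u v w | (u≢v , _) , (v≢w , _) , (u≢w , _) =
    pigeonhole-pair u≢v u≢w v≢w (within u (inj₁ refl)) (within v (inj₂ (inj₁ refl))) (within w (inj₂ (inj₂ refl)))

  non-root-parts : ∀ {e i} → ¬ R e → e ∈ₚ i → TwoOthers {P = e ∈ₚ_} i
  non-root-parts {e} non-root = exactly-3-others (nonroots D e non-root)

  non-root-not-within-two : ∀ {e i j} → ¬ R e → ¬ (∀ l → e ∈ₚ l → l ≡ i ⊎ l ≡ j)
  non-root-not-within-two {e} non-root = exactly-3-not-within-two (nonroots D e non-root)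

  neighbour-in-other-part : ∀ {e f i} (A : TwoOthers {P = e ∈ₚ_} i) → LAdj F e f → ¬ f ∈ₚ i →
    f ∈ₚ TwoOthers.j₁ A ⊎ f ∈ₚ TwoOthers.j₂ A
  neighbour-in-other-part A ef f∉i with common-part ef
  ... | Q , e∈Q , f∈Q with TwoOthers.only A Q e∈Q
  ... | inj₁ refl = ⊥-elim (f∉i f∈Q)
  ... | inj₂ (inj₁ refl) = inj₁ f∈Q
  ... | inj₂ (inj₂ refl) = inj₂ f∈Q

  -- Whether e is a root is not decidable, but the conclusion is.
  another-part : ∀ e i → ∃ λ j → j ≢ i × e ∈ₚ j
  another-part e i with Finₚ.any? (λ j → ¬? (j Fin.≟ i) ×-dec (e ∈ₚ? j))
  ... | yes found = found
  ... | no none = ⊥-elim (¬¬-excluded-middle λ where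
    (yes root) → none (exactly-2+-another (roots D e root) i)
    (no non-root) → none (exactly-2+-another (nonroots D e non-root) i))

-- The structure forced around a triangle

module ForcedStructure
  (F : FinGraph) {R : Edge F → Set} (roots-pendant : ∀ e → R e → Pendant F e)
  (D : ValidDecomposition (LineGraph F) R)
  (claw-free : ClawFree D) (simplicial : EdgePartsSimplicial D)
  (diamond-free : ¬ InducedSub diamond F) (K₄-free : ∀ s → Clique F s → s ≤ 3) where

  open FinGraphProperties F public
  open LineGraphDecomposition F D public

  private
    Vertex : Set
    Vertex = Fin (n F)
    Part′ : Set
    Part′ = Fin (k D)

  apex-unique : ∀ {x y z s} → x ∼ y → x ∼ z → y ∼ z → x ∼ s → y ∼ s → z ≡ s
  apex-unique = triangle-apex-unique F K₄-free diamond-free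

  non-pendant⇒non-root : ∀ {e p q} → Joins e p q → p ≢ q → degree F p ≢ 1 → degree F q ≢ 1 → ¬ R e
  non-pendant⇒non-root {e} jpq p≢q p-deg q-deg root =
    Sum.[ endpoint-degree≢1 (inj₁ refl) , endpoint-degree≢1 (inj₂ refl) ] (roots-pendant e root)
    where
    endpoint-degree≢1 : ∀ {w} → w ∈ᵉ e → degree F w ≢ 1
    endpoint-degree≢1 w∈e with joins-endpoint jpq p≢q w∈e
    ... | inj₁ refl = p-deg
    ... | inj₂ refl = q-deg

  record Spoke (x y z : Vertex) (e : Edge F) : Set where
    constructor spoke
    field
      {tip} : Vertex
      joins-tip : Joins e x tip
      x≢tip : x ≢ tip
      tip≢y : tip ≢ y
      tip≢z : tip ≢ z

  -- In the field names, αx and αy are the other two parts through a (carrying the spokes at x and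
  -- at y), βᵢ those through b and γᵢ those through c.
  record Configuration (x y z : Vertex) (a b c : Edge F) (P : Part′) : Set where
    field
      a-parts : TwoOthers {P = a ∈ₚ_} P
      b-parts : TwoOthers {P = b ∈ₚ_} P
      c-parts : TwoOthers {P = c ∈ₚ_} P
      {e₁ e₂ d₁ d₂} : Edge F
      e₁-spoke : Spoke x y z e₁
      e₂-spoke : Spoke x y z e₂
      d₁-spoke : Spoke y x z d₁
      d₂-spoke : Spoke y x z d₂
      e₁∈αx : e₁ ∈ₚ TwoOthers.j₁ a-parts
      e₂∈αx : e₂ ∈ₚ TwoOthers.j₁ a-parts
      d₁∈αy : d₁ ∈ₚ TwoOthers.j₂ a-parts
      d₂∈αy : d₂ ∈ₚ TwoOthers.j₂ a-parts
      e₁∈β₁ : e₁ ∈ₚ TwoOthers.j₁ b-parts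
      e₂∈β₂ : e₂ ∈ₚ TwoOthers.j₂ b-parts
      d₁∈γ₁ : d₁ ∈ₚ TwoOthers.j₁ c-parts
      d₂∈γ₂ : d₂ ∈ₚ TwoOthers.j₂ c-parts

  swap-sides : ∀ {x y z a b c P} → Configuration x y z a b c P → Configuration y x z a c b P
  swap-sides cfg = record
    { a-parts = TwoOthers-swap a-parts ; b-parts = c-parts ; c-parts = b-parts
    ; e₁-spoke = d₁-spoke ; e₂-spoke = d₂-spoke ; d₁-spoke = e₁-spoke ; d₂-spoke = e₂-spoke
    ; e₁∈αx = d₁∈αy ; e₂∈αx = d₂∈αy ; d₁∈αy = e₁∈αx ; d₂∈αy = e₂∈αx
    ; e₁∈β₁ = d₁∈γ₁ ; e₂∈β₂ = d₂∈γ₂ ; d₁∈γ₁ = e₁∈β₁ ; d₂∈γ₂ = e₂∈β₂ }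
    where
    open Configuration cfg

  swap-spokes : ∀ {x y z a b c P} → Configuration x y z a b c P → Configuration x y z a b c P
  swap-spokes cfg = record
    { a-parts = a-parts ; b-parts = TwoOthers-swap b-parts ; c-parts = TwoOthers-swap c-parts
    ; e₁-spoke = e₂-spoke ; e₂-spoke = e₁-spoke ; d₁-spoke = d₂-spoke ; d₂-spoke = d₁-spoke
    ; e₁∈αx = e₂∈αx ; e₂∈αx = e₁∈αx ; d₁∈αy = d₂∈αy ; d₂∈αy = d₁∈αy
    ; e₁∈β₁ = e₂∈β₂ ; e₂∈β₂ = e₁∈β₁ ; d₁∈γ₁ = d₂∈γ₂ ; d₂∈γ₂ = d₁∈γ₁ }
    where
    open Configuration cfg

  module Triangle (x y z : Vertex) (a b c : Edge F) (xy : x ∼ y) (xz : x ∼ z) (yz : y ∼ z)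
                  (ja : Joins a x y) (jb : Joins b x z) (jc : Joins c y z) where

    x≢y : x ≢ y
    x≢y = ∼⇒≢ xy
    x≢z : x ≢ z
    x≢z = ∼⇒≢ xz
    y≢z : y ≢ z
    y≢z = ∼⇒≢ yz

    a≢b : a ≢ b
    a≢b = outside-endpoint⇒≢ (end₂ ja) jb x≢z (x≢y ∘ sym) y≢z
    a≢c : a ≢ c
    a≢c = outside-endpoint⇒≢ (end₁ ja) jc y≢z x≢y x≢z
    b≢c : b ≢ c
    b≢c = outside-endpoint⇒≢ (end₁ jb) jc y≢z x≢y x≢z

    a∼b : LAdj F a b
    a∼b = a≢b , x , end₁ ja , end₁ jb
    a∼c : LAdj F a c
    a∼c = a≢c , y , end₂ ja , end₁ jc
    b∼c : LAdj F b c
    b∼c = b≢c , z , end₂ jb , end₂ jc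

    ≡a : ∀ {e} → x ∈ᵉ e → y ∈ᵉ e → e ≡ a
    ≡a x∈e y∈e = joins-unique _ a x≢y (joins x∈e y∈e) ja
    ≡b : ∀ {e} → x ∈ᵉ e → z ∈ᵉ e → e ≡ b
    ≡b x∈e z∈e = joins-unique _ b x≢z (joins x∈e z∈e) jb
    ≡c : ∀ {e} → y ∈ᵉ e → z ∈ᵉ e → e ≡ c
    ≡c y∈e z∈e = joins-unique _ c y≢z (joins y∈e z∈e) jc

    c-ends : ∀ {w} → w ∈ᵉ c → w ≡ y ⊎ w ≡ z
    c-ends = joins-endpoint jc y≢z

    meets-a : ∀ {e} → LAdj F a e → x ∈ᵉ e ⊎ y ∈ᵉ e
    meets-a (_ , w , w∈a , w∈e) with joins-endpoint ja x≢y w∈a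
    ... | inj₁ refl = inj₁ w∈e
    ... | inj₂ refl = inj₂ w∈e
    meets-b : ∀ {e} → LAdj F b e → x ∈ᵉ e ⊎ z ∈ᵉ e
    meets-b (_ , w , w∈b , w∈e) with joins-endpoint jb x≢z w∈b
    ... | inj₁ refl = inj₁ w∈e
    ... | inj₂ refl = inj₂ w∈e
    meets-c : ∀ {e} → LAdj F c e → y ∈ᵉ e ⊎ z ∈ᵉ e
    meets-c (_ , w , w∈c , w∈e) with c-ends w∈c
    ... | inj₁ refl = inj₁ w∈e
    ... | inj₂ refl = inj₂ w∈e

    x-degree≢1 : degree F x ≢ 1
    x-degree≢1 = two-neighbours⇒degree≢1 y≢z xy xz
    y-degree≢1 : degree F y ≢ 1
    y-degree≢1 = two-neighbours⇒degree≢1 x≢z (∼-sym xy) yz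
    z-degree≢1 : degree F z ≢ 1
    z-degree≢1 = two-neighbours⇒degree≢1 x≢y (∼-sym xz) (∼-sym yz)

    a-non-root : ¬ R a
    a-non-root = non-pendant⇒non-root ja x≢y x-degree≢1 y-degree≢1
    b-non-root : ¬ R b
    b-non-root = non-pendant⇒non-root jb x≢z x-degree≢1 z-degree≢1
    c-non-root : ¬ R c
    c-non-root = non-pendant⇒non-root jc y≢z y-degree≢1 z-degree≢1

    module Split (P Py Pz Q : Part′) (a∈P : a ∈ₚ P) (b∈P : b ∈ₚ P) (c∉P : ¬ c ∈ₚ P)
                 (a∈Py : a ∈ₚ Py) (c∈Py : c ∈ₚ Py) (b∈Pz : b ∈ₚ Pz) (c∈Pz : c ∈ₚ Pz)
                 (a∈Q : a ∈ₚ Q) (Q≢P : Q ≢ P) (Q≢Py : Q ≢ Py) where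

      a∉Pz : ¬ a ∈ₚ Pz
      a∉Pz a∈Pz = c∉P (subst (c ∈ₚ_) (common-part-unique a≢b a∈Pz b∈Pz a∈P b∈P) c∈Pz)

      Pz≢P : Pz ≢ P
      Pz≢P h = c∉P (subst (c ∈ₚ_) h c∈Pz)

      Q≢Pz : Q ≢ Pz
      Q≢Pz h = a∉Pz (subst (a ∈ₚ_) h a∈Q)

      Pz-at-z : ∀ {e} → e ∈ₚ Pz → e ≢ b → e ≢ c → z ∈ᵉ e
      Pz-at-z e∈Pz e≢b e≢c
        with meets-b (co-members-adjacent b∈Pz e∈Pz (e≢b ∘ sym))
           | meets-c (co-members-adjacent c∈Pz e∈Pz (e≢c ∘ sym))
      ... | inj₂ z∈e | _ = z∈e
      ... | _ | inj₂ z∈e = z∈e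
      ... | inj₁ x∈e | inj₁ y∈e = ⊥-elim (a∉Pz (subst (_∈ₚ Pz) (≡a x∈e y∈e) e∈Pz))

      Q-disjoint-Pz : ∀ {e} → e ∈ₚ Q → e ∈ₚ Pz → ⊥
      Q-disjoint-Pz {e} e∈Q e∈Pz with e ≟ᵉ a | e ≟ᵉ b | e ≟ᵉ c
      ... | yes refl | _ | _ = a∉Pz e∈Pz
      ... | no _ | yes refl | _ = Q≢P (common-part-unique a≢b a∈Q e∈Q a∈P b∈P)
      ... | no _ | no _ | yes refl = Q≢Py (common-part-unique a≢c a∈Q e∈Q a∈Py c∈Py)
      ... | no e≢a | no e≢b | no e≢c
        with Pz-at-z e∈Pz e≢b e≢c | meets-a (co-members-adjacent a∈Q e∈Q (e≢a ∘ sym))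
      ... | z∈e | inj₁ x∈e = e≢b (≡b x∈e z∈e)
      ... | z∈e | inj₂ y∈e = e≢c (≡c y∈e z∈e)

      P-not-edge-part : ¬ IsEdgePart (part D P)
      P-not-edge-part edge-part
        with simplicial P Q Pz edge-part Q≢Pz (Q≢P ∘ sym) (Pz≢P ∘ sym) (a , a∈P , a∈Q) (b , b∈P , b∈Pz)
      ... | e , e∈Q , e∈Pz = Q-disjoint-Pz e∈Q e∈Pz

      third-of-P-at-x : ∀ {g} → g ∈ₚ P → g ≢ a → g ≢ b → x ∈ᵉ g
      third-of-P-at-x g∈P g≢a g≢b
        with meets-a (co-members-adjacent a∈P g∈P (g≢a ∘ sym))
           | meets-b (co-members-adjacent b∈P g∈P (g≢b ∘ sym))
      ... | inj₁ x∈g | _ = x∈g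
      ... | _ | inj₁ x∈g = x∈g
      ... | inj₂ y∈g | inj₂ z∈g = ⊥-elim (c∉P (subst (_∈ₚ P) (≡c y∈g z∈g) g∈P))

      module ThirdMember {g w Rg} (g∈P : g ∈ₚ P) (g≢a : g ≢ a) (g≢b : g ≢ b)
                         (jg : Joins g x w) (x≢w : x ≢ w) (Rg≢P : Rg ≢ P) (g∈Rg : g ∈ₚ Rg) where

        g≢c : g ≢ c
        g≢c h = c∉P (subst (_∈ₚ P) h g∈P)

        xw : x ∼ w
        xw = joins⇒∼ jg x≢w

        w≢y : w ≢ y
        w≢y h = g≢a (≡a (end₁ jg) (subst (_∈ᵉ g) h (end₂ jg)))

        w≢z : w ≢ z
        w≢z h = g≢b (≡b (end₁ jg) (subst (_∈ᵉ g) h (end₂ jg)))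

        Rg≢Q : Rg ≢ Q
        Rg≢Q h = Rg≢P (common-part-unique (g≢a ∘ sym) (subst (a ∈ₚ_) (sym h) a∈Q) g∈Rg a∈P g∈P)

        Rg≢Pz : Rg ≢ Pz
        Rg≢Pz h = Rg≢P (common-part-unique (g≢b ∘ sym) (subst (b ∈ₚ_) (sym h) b∈Pz) g∈Rg b∈P g∈P)

        meets-g : ∀ {e} → e ∈ₚ Rg → e ≢ g → ∃ λ v → (v ≡ x ⊎ v ≡ w) × v ∈ᵉ e
        meets-g e∈Rg e≢g with co-members-adjacent g∈Rg e∈Rg (e≢g ∘ sym)
        ... | _ , v , v∈g , v∈e = v , joins-endpoint jg x≢w v∈g , v∈e

        Pz-disjoint-Rg : ∀ {e} → e ∈ₚ Pz → e ∈ₚ Rg → ⊥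
        Pz-disjoint-Rg {e} e∈Pz e∈Rg with e ≟ᵉ g | e ≟ᵉ b | e ≟ᵉ c
        ... | yes refl | _ | _ with joins-endpoint jg x≢w (Pz-at-z e∈Pz g≢b g≢c)
        ...   | inj₁ z≡x = x≢z (sym z≡x)
        ...   | inj₂ z≡w = w≢z (sym z≡w)
        Pz-disjoint-Rg e∈Pz e∈Rg | no e≢g | yes refl | _ =
          Rg≢P (common-part-unique (g≢b ∘ sym) e∈Rg g∈Rg b∈P g∈P)
        Pz-disjoint-Rg e∈Pz e∈Rg | no e≢g | no _ | yes refl with meets-g e∈Rg e≢g
        ... | v , v∈g , v∈c with v∈g | c-ends v∈c
        ...   | inj₁ refl | inj₁ x≡y = x≢y x≡y
        ...   | inj₁ refl | inj₂ x≡z = x≢z x≡z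
        ...   | inj₂ refl | inj₁ w≡y = w≢y w≡y
        ...   | inj₂ refl | inj₂ w≡z = w≢z w≡z
        Pz-disjoint-Rg {e} e∈Pz e∈Rg | no e≢g | no e≢b | no e≢c
          with Pz-at-z e∈Pz e≢b e≢c | meets-g e∈Rg e≢g
        ... | z∈e | v , inj₁ refl , x∈e = e≢b (≡b x∈e z∈e)
        ... | z∈e | v , inj₂ refl , w∈e =
          w≢y (sym (apex-unique xz xy (∼-sym yz) xw (joins⇒∼ {e} (joins z∈e w∈e) (w≢z ∘ sym))))

        Q-has-x-edge : ∃ λ h → h ∈ₚ Q × x ∈ᵉ h × h ≢ a
        Q-has-x-edge
          with claw-free P Q Pz Rg Q≢Pz (Rg≢Q ∘ sym) (Rg≢Pz ∘ sym) (Q≢P ∘ sym) (Pz≢P ∘ sym) (Rg≢P ∘ sym)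
                 (a , a∈P , a∈Q) (b , b∈P , b∈Pz) (g , g∈P , g∈Rg)
        ... | inj₁ (_ , e∈Q , e∈Pz) = ⊥-elim (Q-disjoint-Pz e∈Q e∈Pz)
        ... | inj₂ (inj₂ (_ , e∈Pz , e∈Rg)) = ⊥-elim (Pz-disjoint-Rg e∈Pz e∈Rg)
        ... | inj₂ (inj₁ (h , h∈Q , h∈Rg)) with h ≟ᵉ a | h ≟ᵉ g
        ... | yes refl | _ = ⊥-elim (Rg≢P (common-part-unique (g≢a ∘ sym) h∈Rg g∈Rg a∈P g∈P))
        ... | no _ | yes refl = ⊥-elim (Q≢P (common-part-unique (g≢a ∘ sym) a∈Q h∈Q a∈P g∈P))
        ... | no h≢a | no h≢g with meets-a (co-members-adjacent a∈Q h∈Q (h≢a ∘ sym))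
        ... | inj₁ x∈h = h , h∈Q , x∈h , h≢a
        ... | inj₂ y∈h with meets-g h∈Rg h≢g
        ...   | v , inj₁ refl , x∈h = h , h∈Q , x∈h , h≢a
        ...   | v , inj₂ refl , w∈h =
          ⊥-elim (w≢z (sym (apex-unique xy xz yz xw (joins⇒∼ {h} (joins y∈h w∈h) (w≢y ∘ sym)))))

      abstract
        Q-has-x-edge : ∃ λ h → h ∈ₚ Q × x ∈ᵉ h × h ≢ a
        Q-has-x-edge with third-member P-not-edge-part a∈P b∈P a≢b
        ... | g , g∈P , g≢a , g≢b with other-end (third-of-P-at-x g∈P g≢a g≢b) | another-part g P
        ... | w , jg , x≢w | Rg , Rg≢P , g∈Rg = ThirdMember.Q-has-x-edge g∈P g≢a g≢b jg x≢w Rg≢P g∈Rg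

  module TriangleClosure (x y z : Vertex) (a b c : Edge F) (xy : x ∼ y) (xz : x ∼ z) (yz : y ∼ z)
                         (ja : Joins a x y) (jb : Joins b x z) (jc : Joins c y z) where

    open Triangle x y z a b c xy xz yz ja jb jc
    private
      module Swapped = Triangle y x z a c b (∼-sym xy) yz xz (joins-sym ja) jc jb

    split-impossible : ∀ {P} → a ∈ₚ P → b ∈ₚ P → ¬ c ∈ₚ P → ⊥
    split-impossible {P} a∈P b∈P c∉P with common-part a∼c | common-part b∼c
    ... | Py , a∈Py , c∈Py | Pz , b∈Pz , c∈Pz = third-part-of-a (non-root-parts a-non-root a∈P)
      where
      Py≢P : Py ≢ P
      Py≢P h = c∉P (subst (c ∈ₚ_) h c∈Py)

      b∉Py : ¬ b ∈ₚ Py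
      b∉Py b∈Py = Py≢P (common-part-unique a≢b a∈Py b∈Py a∈P b∈P)

      -- Q would contain edges h ∋ x and h′ ∋ y other than a; they can only meet at z, so h = b and Q = P.
      impossible : ∀ {Q} → a ∈ₚ Q → Q ≢ P → Q ≢ Py → ⊥
      impossible {Q} a∈Q Q≢P Q≢Py
        with Split.Q-has-x-edge P Py Pz Q a∈P b∈P c∉P a∈Py c∈Py b∈Pz c∈Pz a∈Q Q≢P Q≢Py
           | Swapped.Split.Q-has-x-edge Py P Pz Q a∈Py c∈Py b∉Py a∈P b∈P c∈Pz b∈Pz a∈Q Q≢Py Q≢P
      ... | h , h∈Q , x∈h , h≢a | h′ , h′∈Q , y∈h′ , h′≢a with h ≟ᵉ h′
      ... | yes refl = h≢a (≡a x∈h y∈h′)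
      ... | no h≢h′ with co-members-adjacent h∈Q h′∈Q h≢h′ | other-end {h} x∈h
      ... | _ , v , v∈h , v∈h′ | s , jh , x≢s with joins-endpoint jh x≢s v∈h
      ... | inj₁ refl = h′≢a (≡a v∈h′ y∈h′)
      ... | inj₂ refl with v Fin.≟ y
      ... | yes refl = h≢a (≡a x∈h v∈h)
      ... | no v≢y = Q≢P (common-part-unique a≢b a∈Q (subst (_∈ₚ Q) h≡b h∈Q) a∈P b∈P)
        where
        z≡v : z ≡ v
        z≡v = apex-unique xy xz yz (joins⇒∼ jh x≢s) (joins⇒∼ {h′} (joins y∈h′ v∈h′) (v≢y ∘ sym))
        h≡b : h ≡ b
        h≡b = ≡b x∈h (subst (_∈ᵉ h) (sym z≡v) v∈h)

      third-part-of-a : TwoOthers {P = a ∈ₚ_} P → ⊥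
      third-part-of-a record { j₁ = j₁ ; j₂ = j₂ ; j₁≢j₂ = j₁≢j₂ ; j₁≢i = j₁≢P ; j₂≢i = j₂≢P
                             ; P-j₁ = a∈j₁ ; P-j₂ = a∈j₂ ; only = only } with only Py a∈Py
      ... | inj₁ Py≡P = Py≢P Py≡P
      ... | inj₂ (inj₁ refl) = impossible a∈j₂ j₂≢P (j₁≢j₂ ∘ sym)
      ... | inj₂ (inj₂ refl) = impossible a∈j₁ j₁≢P j₁≢j₂

    triangle-part-closed : ∀ {P} → a ∈ₚ P → b ∈ₚ P → c ∈ₚ P
    triangle-part-closed {P} a∈P b∈P with c ∈ₚ? P
    ... | yes c∈P = c∈P
    ... | no c∉P = ⊥-elim (split-impossible a∈P b∈P c∉P)

  module TrianglePart (x y z : Vertex) (a b c : Edge F) (xy : x ∼ y) (xz : x ∼ z) (yz : y ∼ z)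
                      (ja : Joins a x y) (jb : Joins b x z) (jc : Joins c y z)
                      (P : Part′) (a∈P : a ∈ₚ P) (b∈P : b ∈ₚ P) (c∈P : c ∈ₚ P) where

    open Triangle x y z a b c xy xz yz ja jb jc public

    P-members : ∀ e → e ∈ₚ P → e ≡ a ⊎ e ≡ b ⊎ e ≡ c
    P-members = members-of-triple P a≢b a≢c b≢c a∈P b∈P c∈P

    ∉P : ∀ {e} → e ≢ a → e ≢ b → e ≢ c → ¬ e ∈ₚ P
    ∉P e≢a e≢b e≢c e∈P with P-members _ e∈P
    ... | inj₁ e≡a = e≢a e≡a
    ... | inj₂ (inj₁ e≡b) = e≢b e≡b
    ... | inj₂ (inj₂ e≡c) = e≢c e≡c

    spoke≢a : ∀ {e} → Spoke x y z e → e ≢ a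
    spoke≢a (spoke jw x≢w w≢y _) = outside-endpoint⇒≢ (end₂ jw) ja x≢y (x≢w ∘ sym) w≢y

    spoke≢b : ∀ {e} → Spoke x y z e → e ≢ b
    spoke≢b (spoke jw x≢w _ w≢z) = outside-endpoint⇒≢ (end₂ jw) jb x≢z (x≢w ∘ sym) w≢z

    spoke≢c : ∀ {e} → Spoke x y z e → e ≢ c
    spoke≢c (spoke jw _ _ _) = outside-endpoint⇒≢ (end₁ jw) jc y≢z x≢y x≢z

    spoke∉P : ∀ {e} → Spoke x y z e → ¬ e ∈ₚ P
    spoke∉P s = ∉P (spoke≢a s) (spoke≢b s) (spoke≢c s)

    spoke-meets-a : ∀ {e} → Spoke x y z e → LAdj F a e
    spoke-meets-a s = spoke≢a s ∘ sym , x , end₁ ja , end₁ (Spoke.joins-tip s)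

    spoke-not-meeting-c : ∀ {e} → Spoke x y z e → ¬ LAdj F c e
    spoke-not-meeting-c (spoke je x≢w w≢y w≢z) (_ , v , v∈c , v∈e) with c-ends v∈c | joins-endpoint je x≢w v∈e
    ... | inj₁ refl | inj₁ y≡x = x≢y (sym y≡x)
    ... | inj₁ refl | inj₂ y≡w = w≢y (sym y≡w)
    ... | inj₂ refl | inj₁ z≡x = x≢z (sym z≡x)
    ... | inj₂ refl | inj₂ z≡w = w≢z (sym z≡w)

    spoke-location : ∀ {s} (A : TwoOthers {P = a ∈ₚ_} P) → Spoke x y z s →
      s ∈ₚ TwoOthers.j₁ A ⊎ s ∈ₚ TwoOthers.j₂ A
    spoke-location A sp = neighbour-in-other-part A (spoke-meets-a sp) (spoke∉P sp)

    star-at-x : ∀ {Q f} → Q ≢ P → a ∈ₚ Q → f ∈ₚ Q → f ≢ a → x ∈ᵉ f → ∀ {e} → e ∈ₚ Q → x ∈ᵉ e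
    star-at-x {Q} {f} Q≢P a∈Q f∈Q f≢a x∈f {e} e∈Q with e ≟ᵉ a | e ≟ᵉ f
    ... | yes refl | _ = end₁ ja
    ... | no _ | yes refl = x∈f
    ... | no e≢a | no e≢f with meets-a (co-members-adjacent a∈Q e∈Q (e≢a ∘ sym))
    ... | inj₁ x∈e = x∈e
    ... | inj₂ y∈e with co-members-adjacent f∈Q e∈Q (e≢f ∘ sym) | other-end {f} x∈f
    ... | _ , v , v∈f , v∈e | u , jf , x≢u with joins-endpoint jf x≢u v∈f
    ... | inj₁ refl = v∈e
    ... | inj₂ refl with v Fin.≟ y
    ... | yes refl = ⊥-elim (f≢a (≡a x∈f v∈f))
    ... | no v≢y = ⊥-elim (Q≢P (common-part-unique a≢b a∈Q (subst (_∈ₚ Q) f≡b f∈Q) a∈P b∈P))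
      where
      z≡v : z ≡ v
      z≡v = apex-unique xy xz yz (joins⇒∼ jf x≢u) (joins⇒∼ {e} (joins y∈e v∈e) (v≢y ∘ sym))
      f≡b : f ≡ b
      f≡b = ≡b x∈f (subst (_∈ᵉ f) (sym z≡v) v∈f)

    spoke-star : ∀ {s} → Spoke x y z s → ∃ λ Q → Q ≢ P × a ∈ₚ Q × s ∈ₚ Q × (∀ {e} → e ∈ₚ Q → x ∈ᵉ e)
    spoke-star {s} sp with common-part (spoke-meets-a sp)
    ... | Q , a∈Q , s∈Q = Q , Q≢P , a∈Q , s∈Q , star-at-x Q≢P a∈Q s∈Q (spoke≢a sp) (end₁ (Spoke.joins-tip sp))
      where
      Q≢P : Q ≢ P
      Q≢P Q≡P = spoke∉P sp (subst (s ∈ₚ_) Q≡P s∈Q)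

    OuterNeighbour : Set
    OuterNeighbour = ∃ λ t → x ∼ t × t ≢ y × t ≢ z

    outer-neighbour? : Dec OuterNeighbour
    outer-neighbour? = Finₚ.any? λ t → (adj F x t Boolₚ.≟ true) ×-dec ¬? (t Fin.≟ y) ×-dec ¬? (t Fin.≟ z)

    no-outer-neighbour : ¬ OuterNeighbour → ∀ t → x ∼ t → t ≡ y ⊎ t ≡ z
    no-outer-neighbour none t xt with t Fin.≟ y | t Fin.≟ z
    ... | yes t≡y | _ = inj₁ t≡y
    ... | no _ | yes t≡z = inj₂ t≡z
    ... | no t≢y | no t≢z = ⊥-elim (none (t , xt , t≢y , t≢z))

    outer-neighbour⇒spoke : OuterNeighbour → ∃ (Spoke x y z)
    outer-neighbour⇒spoke (t , xt , t≢y , t≢z) with edge-joining xt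
    ... | e , jt = e , spoke jt (∼⇒≢ xt) t≢y t≢z

    module Degree₂ (z-neighbours : ∀ t → z ∼ t → t ≡ x ⊎ t ≡ y) where

      b-part-member-is-spoke : ∀ {Q e} → Q ≢ P → b ∈ₚ Q → e ∈ₚ Q → e ≢ b → Spoke x y z e
      b-part-member-is-spoke {Q} {e} Q≢P b∈Q e∈Q e≢b with e ≟ᵉ a | e ≟ᵉ c
      ... | yes refl | _ = ⊥-elim (Q≢P (common-part-unique a≢b e∈Q b∈Q a∈P b∈P))
      ... | no _ | yes refl = ⊥-elim (Q≢P (common-part-unique b≢c b∈Q e∈Q b∈P c∈P))
      ... | no e≢a | no e≢c with meets-b (co-members-adjacent b∈Q e∈Q (e≢b ∘ sym))
      ... | inj₂ z∈e with other-end {e} z∈e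
      ...   | t , jt , z≢t with z-neighbours t (joins⇒∼ jt z≢t)
      ...     | inj₁ refl = ⊥-elim (e≢b (≡b (end₂ jt) z∈e))
      ...     | inj₂ refl = ⊥-elim (e≢c (≡c (end₂ jt) z∈e))
      b-part-member-is-spoke {Q} {e} Q≢P b∈Q e∈Q e≢b | no e≢a | no e≢c | inj₁ x∈e
        with other-end {e} x∈e
      ... | w , jw , x≢w = spoke jw x≢w w≢y w≢z
        where
        w≢y : w ≢ y
        w≢y w≡y = e≢a (≡a x∈e (subst (_∈ᵉ e) w≡y (end₂ jw)))
        w≢z : w ≢ z
        w≢z w≡z = e≢b (≡b x∈e (subst (_∈ᵉ e) w≡z (end₂ jw)))

      b-part-spoke : ∀ {Q} → Q ≢ P → b ∈ₚ Q → ∃ λ e → e ∈ₚ Q × Spoke x y z e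
      b-part-spoke Q≢P b∈Q with another-member b∈Q
      ... | e , e∈Q , e≢b = e , e∈Q , b-part-member-is-spoke Q≢P b∈Q e∈Q e≢b

  module Degree₂Triangle (x y z : Vertex) (a b c : Edge F) (xy : x ∼ y) (xz : x ∼ z) (yz : y ∼ z)
                         (ja : Joins a x y) (jb : Joins b x z) (jc : Joins c y z)
                         (P : Part′) (a∈P : a ∈ₚ P) (b∈P : b ∈ₚ P) (c∈P : c ∈ₚ P)
                         (z-neighbours : ∀ t → z ∼ t → t ≡ x ⊎ t ≡ y) where

    open TrianglePart x y z a b c xy xz yz ja jb jc P a∈P b∈P c∈P public
    open Degree₂ z-neighbours public

    module Vy = TrianglePart y x z a c b (∼-sym xy) yz xz (joins-sym ja) jc jb P a∈P c∈P b∈P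
    module Vy₂ = Vy.Degree₂ (λ t zt → Sum.swap (z-neighbours t zt))

    x-spoke≢y-spoke : ∀ {e d} → Spoke x y z e → Spoke y x z d → e ≢ d
    x-spoke≢y-spoke (spoke je _ _ _) (spoke jd y≢u u≢x _) =
      outside-endpoint⇒≢ (end₁ je) jd y≢u x≢y (u≢x ∘ sym)

    spokes-apart : ∀ {e d Q} → Spoke x y z e → Spoke y x z d → e ∈ₚ Q → d ∈ₚ Q → ⊥
    spokes-apart se@(spoke je x≢w w≢y w≢z) sd@(spoke jd y≢u _ _) e∈Q d∈Q
      with co-members-adjacent e∈Q d∈Q (x-spoke≢y-spoke se sd)
    ... | _ , v , v∈e , v∈d with joins-endpoint je x≢w v∈e | joins-endpoint jd y≢u v∈d
    ... | inj₁ refl | inj₁ x≡y = x≢y x≡y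
    ... | inj₁ refl | inj₂ x≡u = Spoke.tip≢y sd (sym x≡u)
    ... | inj₂ refl | inj₁ w≡y = w≢y w≡y
    ... | inj₂ refl | inj₂ refl = w≢z (sym (apex-unique xy xz yz (joins⇒∼ je x≢w) (joins⇒∼ jd y≢u)))

    orient : ∀ {s} → TwoOthers {P = a ∈ₚ_} P → Spoke x y z s →
      Σ (TwoOthers {P = a ∈ₚ_} P) λ A → s ∈ₚ TwoOthers.j₁ A
    orient A sp with spoke-location A sp
    ... | inj₁ s∈j₁ = A , s∈j₁
    ... | inj₂ s∈j₂ = TwoOthers-swap A , s∈j₂

    separate : ∀ {e₁ e₂ d₁ d₂} (A : TwoOthers {P = a ∈ₚ_} P) →
      Spoke x y z e₁ → Spoke x y z e₂ → Spoke y x z d₁ → Spoke y x z d₂ →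
      let open TwoOthers A in
      e₁ ∈ₚ j₁ → e₂ ∈ₚ j₁ ⊎ e₂ ∈ₚ j₂ → d₁ ∈ₚ j₁ ⊎ d₁ ∈ₚ j₂ → d₂ ∈ₚ j₁ ⊎ d₂ ∈ₚ j₂ →
      e₂ ∈ₚ j₁ × d₁ ∈ₚ j₂ × d₂ ∈ₚ j₂
    separate A se₁ se₂ sd₁ sd₂ e₁∈ _ (inj₁ d₁∈) _ = ⊥-elim (spokes-apart se₁ sd₁ e₁∈ d₁∈)
    separate A se₁ se₂ sd₁ sd₂ e₁∈ (inj₂ e₂∈) (inj₂ d₁∈) _ = ⊥-elim (spokes-apart se₂ sd₁ e₂∈ d₁∈)
    separate A se₁ se₂ sd₁ sd₂ e₁∈ (inj₁ e₂∈) (inj₂ d₁∈) (inj₁ d₂∈) = ⊥-elim (spokes-apart se₁ sd₂ e₁∈ d₂∈)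
    separate A se₁ se₂ sd₁ sd₂ e₁∈ (inj₁ e₂∈) (inj₂ d₁∈) (inj₂ d₂∈) = e₂∈ , d₁∈ , d₂∈

    private
      a-others : TwoOthers {P = a ∈ₚ_} P
      a-others = non-root-parts a-non-root a∈P
      b-others : TwoOthers {P = b ∈ₚ_} P
      b-others = non-root-parts b-non-root b∈P
      c-others : TwoOthers {P = c ∈ₚ_} P
      c-others = non-root-parts c-non-root c∈P

    configuration : Configuration x y z a b c P
    configuration
      with b-part-spoke (TwoOthers.j₁≢i b-others) (TwoOthers.P-j₁ b-others)
         | b-part-spoke (TwoOthers.j₂≢i b-others) (TwoOthers.P-j₂ b-others)
         | Vy₂.b-part-spoke (TwoOthers.j₁≢i c-others) (TwoOthers.P-j₁ c-others)
         | Vy₂.b-part-spoke (TwoOthers.j₂≢i c-others) (TwoOthers.P-j₂ c-others)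
    ... | e₁ , e₁∈β₁ , se₁ | e₂ , e₂∈β₂ , se₂ | d₁ , d₁∈γ₁ , sd₁ | d₂ , d₂∈γ₂ , sd₂ with orient a-others se₁
    ... | A , e₁∈αx
      with separate A se₁ se₂ sd₁ sd₂ e₁∈αx
             (spoke-location A se₂) (Vy.spoke-location A sd₁) (Vy.spoke-location A sd₂)
    ... | e₂∈αx , d₁∈αy , d₂∈αy = record
      { a-parts = A ; b-parts = b-others ; c-parts = c-others
      ; e₁-spoke = se₁ ; e₂-spoke = se₂ ; d₁-spoke = sd₁ ; d₂-spoke = sd₂
      ; e₁∈αx = e₁∈αx ; e₂∈αx = e₂∈αx ; d₁∈αy = d₁∈αy ; d₂∈αy = d₂∈αy
      ; e₁∈β₁ = e₁∈β₁ ; e₂∈β₂ = e₂∈β₂ ; d₁∈γ₁ = d₁∈γ₁ ; d₂∈γ₂ = d₂∈γ₂ }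

    -- Facts about x and its first spoke e₁; the other spokes are covered by swap-sides and swap-spokes.
    module Side (cfg : Configuration x y z a b c P) where

      open Configuration cfg
      open TwoOthers using (j₁; j₂; j₁≢j₂; j₁≢i; P-j₁; P-j₂)

      αx β₁ β₂ : Part′
      αx = j₁ a-parts
      β₁ = j₁ b-parts
      β₂ = j₂ b-parts

      b∈β₁ : b ∈ₚ β₁
      b∈β₁ = P-j₁ b-parts

      e₁≢e₂ : e₁ ≢ e₂
      e₁≢e₂ e₁≡e₂ = j₁≢j₂ b-parts (common-part-unique (spoke≢b e₁-spoke ∘ sym)
        b∈β₁ e₁∈β₁ (P-j₂ b-parts) (subst (_∈ₚ β₂) (sym e₁≡e₂) e₂∈β₂))

      αx-members : ∀ e → e ∈ₚ αx → e ≡ a ⊎ e ≡ e₁ ⊎ e ≡ e₂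
      αx-members = members-of-triple αx (spoke≢a e₁-spoke ∘ sym) (spoke≢a e₂-spoke ∘ sym) e₁≢e₂
        (P-j₁ a-parts) e₁∈αx e₂∈αx

      spoke∈αx : ∀ {s} → Spoke x y z s → s ∈ₚ αx
      spoke∈αx sp with spoke-location a-parts sp
      ... | inj₁ s∈αx = s∈αx
      ... | inj₂ s∈αy = ⊥-elim (spokes-apart sp d₁-spoke s∈αy d₁∈αy)

      edges-at-x : ∀ {e} → x ∈ᵉ e → e ≡ a ⊎ e ≡ b ⊎ e ≡ e₁ ⊎ e ≡ e₂
      edges-at-x {e} x∈e with other-end {e} x∈e
      ... | t , jt , x≢t with t Fin.≟ y | t Fin.≟ z
      ... | yes refl | _ = inj₁ (joins-unique e a x≢y jt ja)
      ... | no _ | yes refl = inj₂ (inj₁ (joins-unique e b x≢z jt jb))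
      ... | no t≢y | no t≢z with αx-members e (spoke∈αx (spoke jt x≢t t≢y t≢z))
      ... | inj₁ e≡a = inj₁ e≡a
      ... | inj₂ (inj₁ e≡e₁) = inj₂ (inj₂ (inj₁ e≡e₁))
      ... | inj₂ (inj₂ e≡e₂) = inj₂ (inj₂ (inj₂ e≡e₂))

      β₁-members : ∀ e → e ∈ₚ β₁ → e ≡ b ⊎ e ≡ e₁
      β₁-members e e∈β₁ with e ≟ᵉ b
      ... | yes e≡b = inj₁ e≡b
      ... | no e≢b with b-part-member-is-spoke (j₁≢i b-parts) b∈β₁ e∈β₁ e≢b
      ... | sp with αx-members e (spoke∈αx sp)
      ... | inj₁ e≡a = ⊥-elim (spoke≢a sp e≡a)
      ... | inj₂ (inj₁ e≡e₁) = inj₂ e≡e₁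
      ... | inj₂ (inj₂ e≡e₂) = ⊥-elim (j₁≢j₂ b-parts (common-part-unique (spoke≢b e₂-spoke ∘ sym)
                                 b∈β₁ (subst (_∈ₚ β₁) e≡e₂ e∈β₁) (P-j₂ b-parts) e₂∈β₂))

      -- β₁ = {b, e₁} is an edge part, so the parts through e₁ and through b must meet.
      e₁-parts : ∀ Q → e₁ ∈ₚ Q → Q ≡ αx ⊎ Q ≡ β₁
      e₁-parts Q e₁∈Q with Q Fin.≟ αx | Q Fin.≟ β₁
      ... | yes Q≡αx | _ = inj₁ Q≡αx
      ... | no _ | yes Q≡β₁ = inj₂ Q≡β₁
      ... | no Q≢αx | no Q≢β₁
        with simplicial β₁ Q P (pair-part⇒edge-part β₁ β₁-members) Q≢P (Q≢β₁ ∘ sym) (j₁≢i b-parts)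
               (e₁ , e₁∈β₁ , e₁∈Q) (b , b∈β₁ , b∈P)
        where
        Q≢P : Q ≢ P
        Q≢P Q≡P = spoke∉P e₁-spoke (subst (e₁ ∈ₚ_) Q≡P e₁∈Q)
      ... | g , g∈Q , g∈P with P-members g g∈P
      ... | inj₁ refl = ⊥-elim (Q≢αx
        (common-part-unique (spoke≢a e₁-spoke ∘ sym) g∈Q e₁∈Q (P-j₁ a-parts) e₁∈αx))
      ... | inj₂ (inj₁ refl) = ⊥-elim (Q≢β₁
        (common-part-unique (spoke≢b e₁-spoke ∘ sym) g∈Q e₁∈Q b∈β₁ e₁∈β₁))
      ... | inj₂ (inj₂ refl) = ⊥-elim (spoke-not-meeting-c e₁-spoke
        (co-members-adjacent g∈Q e₁∈Q (spoke≢c e₁-spoke ∘ sym)))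

      tip-degree≡1 : degree F (Spoke.tip e₁-spoke) ≡ 1
      tip-degree≡1 with degree F (Spoke.tip e₁-spoke) ℕ.≟ 1
      ... | yes deg≡1 = deg≡1
      ... | no deg≢1 = ⊥-elim (non-root-not-within-two
        (non-pendant⇒non-root (Spoke.joins-tip e₁-spoke) (Spoke.x≢tip e₁-spoke) x-degree≢1 deg≢1) e₁-parts)

      edges-at-tip : ∀ {e} → Spoke.tip e₁-spoke ∈ᵉ e → e ≡ e₁
      edges-at-tip {e} w∈e with other-end {e} w∈e
      ... | t , jt , w≢t
        with degree≡1⇒neighbour-unique tip-degree≡1 (joins⇒∼ jt w≢t)
               (∼-sym (joins⇒∼ (Spoke.joins-tip e₁-spoke) (Spoke.x≢tip e₁-spoke)))
      ... | refl = joins-unique e e₁ (Spoke.x≢tip e₁-spoke ∘ sym) jt (joins-sym (Spoke.joins-tip e₁-spoke))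

  module Labelling (connected : Connected F)
                  (x y z : Vertex) (a b c : Edge F) (xy : x ∼ y) (xz : x ∼ z) (yz : y ∼ z)
                  (ja : Joins a x y) (jb : Joins b x z) (jc : Joins c y z)
                  (P : Part′) (a∈P : a ∈ₚ P) (b∈P : b ∈ₚ P) (c∈P : c ∈ₚ P)
                  (z-neighbours : ∀ t → z ∼ t → t ≡ x ⊎ t ≡ y)
                  (cfg : Configuration x y z a b c P) where

    private
      module T = Degree₂Triangle x y z a b c xy xz yz ja jb jc P a∈P b∈P c∈P z-neighbours
      module Tʸ = Degree₂Triangle y x z a c b (∼-sym xy) yz xz (joins-sym ja) jc jb P a∈P c∈P b∈P
                    (λ t zt → Sum.swap (z-neighbours t zt))
      module X₁ = T.Side cfg
      module X₂ = T.Side (swap-spokes cfg)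
      module Y₁ = Tʸ.Side (swap-sides cfg)
      module Y₂ = Tʸ.Side (swap-spokes (swap-sides cfg))
      open Configuration cfg
      open TwoOthers using (j₁; j₂; P-j₁; P-j₂; only)
      open T using (x≢y; x≢z; y≢z)

    vertex : Fin 7 → Vertex
    vertex = Vec.lookup (x ∷ y ∷ z ∷ Spoke.tip e₁-spoke ∷ Spoke.tip e₂-spoke
                           ∷ Spoke.tip d₁-spoke ∷ Spoke.tip d₂-spoke ∷ [])

    -- in the order of the points a, …, g of Γc
    edge : Fin 7 → Edge F
    edge = Vec.lookup (a ∷ b ∷ c ∷ d₁ ∷ e₁ ∷ e₂ ∷ d₂ ∷ [])

    block : Fin 7 → Part′
    block = Vec.lookup (P ∷ j₂ a-parts ∷ j₁ a-parts ∷ j₁ b-parts ∷ j₂ b-parts ∷ j₁ c-parts ∷ j₂ c-parts ∷ [])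

    private
      labelled : ∀ j {e} → e ≡ edge j → ∃ λ j′ → edge j′ ≡ e
      labelled j e≡ = j , sym e≡

      labelled-block : ∀ k {Q} → Q ≡ block k → ∃ λ k′ → block k′ ≡ Q
      labelled-block k Q≡ = k , sym Q≡

      endpoint-of : ∀ p q {e v} → Joins e (vertex p) (vertex q) → vertex p ≢ vertex q → v ∈ᵉ e →
        ∃ λ i → vertex i ≡ v
      endpoint-of p q jpq p≢q v∈e with joins-endpoint jpq p≢q v∈e
      ... | inj₁ v≡p = p , sym v≡p
      ... | inj₂ v≡q = q , sym v≡q

    edges-at-vertex : ∀ i {e} → vertex i ∈ᵉ e → ∃ λ j → edge j ≡ e
    edges-at-vertex zero x∈e with X₁.edges-at-x x∈e
    ... | inj₁ e≡a = labelled (# 0) e≡a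
    ... | inj₂ (inj₁ e≡b) = labelled (# 1) e≡b
    ... | inj₂ (inj₂ (inj₁ e≡e₁)) = labelled (# 4) e≡e₁
    ... | inj₂ (inj₂ (inj₂ e≡e₂)) = labelled (# 5) e≡e₂
    edges-at-vertex (suc zero) y∈e with Y₁.edges-at-x y∈e
    ... | inj₁ e≡a = labelled (# 0) e≡a
    ... | inj₂ (inj₁ e≡c) = labelled (# 2) e≡c
    ... | inj₂ (inj₂ (inj₁ e≡d₁)) = labelled (# 3) e≡d₁
    ... | inj₂ (inj₂ (inj₂ e≡d₂)) = labelled (# 6) e≡d₂
    edges-at-vertex (suc (suc zero)) {e} z∈e with other-end {e} z∈e
    ... | t , jt , z≢t with z-neighbours t (joins⇒∼ jt z≢t)
    ... | inj₁ refl = labelled (# 1) (joins-unique e b x≢z (joins-sym jt) jb)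
    ... | inj₂ refl = labelled (# 2) (joins-unique e c y≢z (joins-sym jt) jc)
    edges-at-vertex (suc (suc (suc zero))) = labelled (# 4) ∘ X₁.edges-at-tip
    edges-at-vertex (suc (suc (suc (suc zero)))) = labelled (# 5) ∘ X₂.edges-at-tip
    edges-at-vertex (suc (suc (suc (suc (suc zero))))) = labelled (# 3) ∘ Y₁.edges-at-tip
    edges-at-vertex (suc (suc (suc (suc (suc (suc zero)))))) = labelled (# 6) ∘ Y₂.edges-at-tip

    edge-endpoint : ∀ j {v} → v ∈ᵉ edge j → ∃ λ i → vertex i ≡ v
    edge-endpoint zero = endpoint-of (# 0) (# 1) ja x≢y
    edge-endpoint (suc zero) = endpoint-of (# 0) (# 2) jb x≢z
    edge-endpoint (suc (suc zero)) = endpoint-of (# 1) (# 2) jc y≢z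
    edge-endpoint (suc (suc (suc zero))) = endpoint-of (# 1) (# 5) (Spoke.joins-tip d₁-spoke) (Spoke.x≢tip d₁-spoke)
    edge-endpoint (suc (suc (suc (suc zero)))) = endpoint-of (# 0) (# 3) (Spoke.joins-tip e₁-spoke) (Spoke.x≢tip e₁-spoke)
    edge-endpoint (suc (suc (suc (suc (suc zero))))) = endpoint-of (# 0) (# 4) (Spoke.joins-tip e₂-spoke) (Spoke.x≢tip e₂-spoke)
    edge-endpoint (suc (suc (suc (suc (suc (suc zero)))))) = endpoint-of (# 1) (# 6) (Spoke.joins-tip d₂-spoke) (Spoke.x≢tip d₂-spoke)

    vertex-surjective : ∀ v → ∃ λ i → vertex i ≡ v
    vertex-surjective = connected-closed⇒all connected (# 0 , refl) step
      where
      step : ∀ {u v} → (∃ λ i → vertex i ≡ u) → u ∼ v → ∃ λ i → vertex i ≡ v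
      step (i , refl) uv with edge-joining uv
      ... | e , je with edges-at-vertex i {e} (end₁ je)
      ... | j , edge-j≡e = edge-endpoint j (subst (_ ∈ᵉ_) (sym edge-j≡e) (end₂ je))

    edge-surjective : ∀ e → ∃ λ j → edge j ≡ e
    edge-surjective e with vertex-surjective (lower e)
    ... | i , vi≡ = edges-at-vertex i (inj₁ vi≡)

    parts-of-edge : ∀ j {Q} → edge j ∈ₚ Q → ∃ λ k → block k ≡ Q
    parts-of-edge zero {Q} a∈Q with only a-parts Q a∈Q
    ... | inj₁ Q≡ = labelled-block (# 0) Q≡
    ... | inj₂ (inj₁ Q≡) = labelled-block (# 2) Q≡
    ... | inj₂ (inj₂ Q≡) = labelled-block (# 1) Q≡
    parts-of-edge (suc zero) {Q} b∈Q with only b-parts Q b∈Q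
    ... | inj₁ Q≡ = labelled-block (# 0) Q≡
    ... | inj₂ (inj₁ Q≡) = labelled-block (# 3) Q≡
    ... | inj₂ (inj₂ Q≡) = labelled-block (# 4) Q≡
    parts-of-edge (suc (suc zero)) {Q} c∈Q with only c-parts Q c∈Q
    ... | inj₁ Q≡ = labelled-block (# 0) Q≡
    ... | inj₂ (inj₁ Q≡) = labelled-block (# 5) Q≡
    ... | inj₂ (inj₂ Q≡) = labelled-block (# 6) Q≡
    parts-of-edge (suc (suc (suc zero))) {Q} d₁∈Q with Y₁.e₁-parts Q d₁∈Q
    ... | inj₁ Q≡ = labelled-block (# 1) Q≡
    ... | inj₂ Q≡ = labelled-block (# 5) Q≡
    parts-of-edge (suc (suc (suc (suc zero)))) {Q} e₁∈Q with X₁.e₁-parts Q e₁∈Q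
    ... | inj₁ Q≡ = labelled-block (# 2) Q≡
    ... | inj₂ Q≡ = labelled-block (# 3) Q≡
    parts-of-edge (suc (suc (suc (suc (suc zero))))) {Q} e₂∈Q with X₂.e₁-parts Q e₂∈Q
    ... | inj₁ Q≡ = labelled-block (# 2) Q≡
    ... | inj₂ Q≡ = labelled-block (# 4) Q≡
    parts-of-edge (suc (suc (suc (suc (suc (suc zero)))))) {Q} d₂∈Q with Y₂.e₁-parts Q d₂∈Q
    ... | inj₁ Q≡ = labelled-block (# 1) Q≡
    ... | inj₂ Q≡ = labelled-block (# 6) Q≡

    block-surjective : ∀ Q → ∃ λ k → block k ≡ Q
    block-surjective Q with some-member Q
    ... | e , e∈Q with edge-surjective e
    ... | j , edge-j≡e = parts-of-edge j (subst (_∈ₚ Q) (sym edge-j≡e) e∈Q)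

    incidences : ∀ k → All (λ i → edge i ∈ₚ block k) (Γc-blocks k)
    incidences zero = a∈P ∷ b∈P ∷ c∈P ∷ []
    incidences (suc zero) = P-j₂ a-parts ∷ d₁∈αy ∷ d₂∈αy ∷ []
    incidences (suc (suc zero)) = P-j₁ a-parts ∷ e₁∈αx ∷ e₂∈αx ∷ []
    incidences (suc (suc (suc zero))) = P-j₁ b-parts ∷ e₁∈β₁ ∷ []
    incidences (suc (suc (suc (suc zero)))) = P-j₂ b-parts ∷ e₂∈β₂ ∷ []
    incidences (suc (suc (suc (suc (suc zero))))) = P-j₁ c-parts ∷ d₁∈γ₁ ∷ []
    incidences (suc (suc (suc (suc (suc (suc zero)))))) = P-j₂ c-parts ∷ d₂∈γ₂ ∷ []

    private
      among-two : ∀ {i₀ i₁ e} → e ≡ edge i₀ ⊎ e ≡ edge i₁ → Any (λ i → edge i ≡ e) (i₀ ∷ i₁ ∷ [])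
      among-two (inj₁ e≡) = here (sym e≡)
      among-two (inj₂ e≡) = there (here (sym e≡))

      among-three : ∀ {i₀ i₁ i₂ e} → e ≡ edge i₀ ⊎ e ≡ edge i₁ ⊎ e ≡ edge i₂ →
        Any (λ i → edge i ≡ e) (i₀ ∷ i₁ ∷ i₂ ∷ [])
      among-three (inj₁ e≡) = here (sym e≡)
      among-three (inj₂ e∈) = there (among-two e∈)

    contents : ∀ k {e} → e ∈ₚ block k → Any (λ i → edge i ≡ e) (Γc-blocks k)
    contents zero = among-three ∘ T.P-members _
    contents (suc zero) = among-three ∘ Y₁.αx-members _
    contents (suc (suc zero)) = among-three ∘ X₁.αx-members _
    contents (suc (suc (suc zero))) = among-two ∘ X₁.β₁-members _
    contents (suc (suc (suc (suc zero)))) = among-two ∘ X₂.β₁-members _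
    contents (suc (suc (suc (suc (suc zero))))) = among-two ∘ Y₁.β₁-members _
    contents (suc (suc (suc (suc (suc (suc zero)))))) = among-two ∘ Y₂.β₁-members _

    edges-distinct : Unique (a ∷ b ∷ c ∷ d₁ ∷ e₁ ∷ e₂ ∷ d₂ ∷ [])
    edges-distinct =
        (T.a≢b ∷ T.a≢c ∷ ≢-sym (Tʸ.spoke≢a d₁-spoke) ∷ ≢-sym (T.spoke≢a e₁-spoke)
          ∷ ≢-sym (T.spoke≢a e₂-spoke) ∷ ≢-sym (Tʸ.spoke≢a d₂-spoke) ∷ [])
      ∷ (T.b≢c ∷ ≢-sym (Tʸ.spoke≢c d₁-spoke) ∷ ≢-sym (T.spoke≢b e₁-spoke)
          ∷ ≢-sym (T.spoke≢b e₂-spoke) ∷ ≢-sym (Tʸ.spoke≢c d₂-spoke) ∷ [])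
      ∷ (≢-sym (Tʸ.spoke≢b d₁-spoke) ∷ ≢-sym (T.spoke≢c e₁-spoke)
          ∷ ≢-sym (T.spoke≢c e₂-spoke) ∷ ≢-sym (Tʸ.spoke≢b d₂-spoke) ∷ [])
      ∷ (≢-sym (T.x-spoke≢y-spoke e₁-spoke d₁-spoke) ∷ ≢-sym (T.x-spoke≢y-spoke e₂-spoke d₁-spoke)
          ∷ Y₁.e₁≢e₂ ∷ [])
      ∷ (X₁.e₁≢e₂ ∷ T.x-spoke≢y-spoke e₁-spoke d₂-spoke ∷ [])
      ∷ (T.x-spoke≢y-spoke e₂-spoke d₂-spoke ∷ [])
      ∷ []
      ∷ []

    iso : Iso (IncGraph D) Γc
    iso = Γc-labelling⇒iso edge block (lookup-injective edges-distinct) edge-surjective block-surjective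
      incidences contents

  Γc-from-degree₂-vertex : Connected F → ∀ {x y z a b c P} (xy : x ∼ y) (xz : x ∼ z) (yz : y ∼ z)
    (ja : Joins a x y) (jb : Joins b x z) (jc : Joins c y z) (a∈P : a ∈ₚ P) (b∈P : b ∈ₚ P) (c∈P : c ∈ₚ P) →
    (∀ t → z ∼ t → t ≡ x ⊎ t ≡ y) → Iso (IncGraph D) Γc
  Γc-from-degree₂-vertex connected xy xz yz ja jb jc a∈P b∈P c∈P z-neighbours =
    Labelling.iso connected _ _ _ _ _ _ xy xz yz ja jb jc _ a∈P b∈P c∈P z-neighbours
      (Degree₂Triangle.configuration _ _ _ _ _ _ xy xz yz ja jb jc _ a∈P b∈P c∈P z-neighbours)

  module TriangleRotations (x y z : Vertex) (a b c : Edge F) (xy : x ∼ y) (xz : x ∼ z) (yz : y ∼ z)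
                           (ja : Joins a x y) (jb : Joins b x z) (jc : Joins c y z)
                           (P : Part′) (a∈P : a ∈ₚ P) (b∈P : b ∈ₚ P) (c∈P : c ∈ₚ P) where

    module Vx = TrianglePart x y z a b c xy xz yz ja jb jc P a∈P b∈P c∈P
    module Vy = TrianglePart y z x c a b yz (∼-sym xy) (∼-sym xz) jc (joins-sym ja) (joins-sym jb) P c∈P a∈P b∈P
    module Vz = TrianglePart z x y b c a (∼-sym xz) (∼-sym yz) xy (joins-sym jb) (joins-sym jc) ja P b∈P c∈P a∈P

    open Vx using (a≢b; a≢c; b≢c; ≡a; ≡b; ≡c)

    -- The three stars through the spokes pairwise miss each other, which contradicts claw-freeness at P.
    not-all-outer-neighbours : Vx.OuterNeighbour → Vy.OuterNeighbour → Vz.OuterNeighbour → ⊥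
    not-all-outer-neighbours nx ny nz
      with Vx.outer-neighbour⇒spoke nx | Vy.outer-neighbour⇒spoke ny | Vz.outer-neighbour⇒spoke nz
    ... | sx , spx | sy , spy | _ , spz
      with Vx.spoke-star spx | Vy.spoke-star spy | Vz.spoke-star spz
    ... | Qx , Qx≢P , a∈Qx , sx∈Qx , star-x | Qy , Qy≢P , c∈Qy , sy∈Qy , star-y
        | Qz , Qz≢P , b∈Qz , _ , star-z =
      claw-case (claw-free P Qx Qy Qz Qx≢Qy Qx≢Qz Qy≢Qz (Qx≢P ∘ sym) (Qy≢P ∘ sym) (Qz≢P ∘ sym)
                  (a , a∈P , a∈Qx) (c , c∈P , c∈Qy) (b , b∈P , b∈Qz))
      where
      xy-disjoint : ∀ {e} → e ∈ₚ Qx → e ∈ₚ Qy → ⊥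
      xy-disjoint {e} e∈Qx e∈Qy = Qy≢P (common-part-unique a≢c
        (subst (_∈ₚ Qy) (≡a (star-x e∈Qx) (star-y e∈Qy)) e∈Qy) c∈Qy a∈P c∈P)
      xz-disjoint : ∀ {e} → e ∈ₚ Qx → e ∈ₚ Qz → ⊥
      xz-disjoint {e} e∈Qx e∈Qz = Qx≢P (common-part-unique a≢b
        a∈Qx (subst (_∈ₚ Qx) (≡b (star-x e∈Qx) (star-z e∈Qz)) e∈Qx) a∈P b∈P)
      yz-disjoint : ∀ {e} → e ∈ₚ Qy → e ∈ₚ Qz → ⊥
      yz-disjoint {e} e∈Qy e∈Qz = Qz≢P (common-part-unique b≢c
        b∈Qz (subst (_∈ₚ Qz) (≡c (star-y e∈Qy) (star-z e∈Qz)) e∈Qz) b∈P c∈P)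
      Qx≢Qy : Qx ≢ Qy
      Qx≢Qy h = xy-disjoint sx∈Qx (subst (sx ∈ₚ_) h sx∈Qx)
      Qx≢Qz : Qx ≢ Qz
      Qx≢Qz h = xz-disjoint sx∈Qx (subst (sx ∈ₚ_) h sx∈Qx)
      Qy≢Qz : Qy ≢ Qz
      Qy≢Qz h = yz-disjoint sy∈Qy (subst (sy ∈ₚ_) h sy∈Qy)
      claw-case : Meet D Qx Qy ⊎ Meet D Qx Qz ⊎ Meet D Qy Qz → ⊥
      claw-case (inj₁ (_ , e∈Qx , e∈Qy)) = xy-disjoint e∈Qx e∈Qy
      claw-case (inj₂ (inj₁ (_ , e∈Qx , e∈Qz))) = xz-disjoint e∈Qx e∈Qz
      claw-case (inj₂ (inj₂ (_ , e∈Qy , e∈Qz))) = yz-disjoint e∈Qy e∈Qz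

    Γc-from-rotations : Connected F → Iso (IncGraph D) Γc
    Γc-from-rotations connected with Vz.outer-neighbour? | Vy.outer-neighbour? | Vx.outer-neighbour?
    ... | no none | _ | _ = Γc-from-degree₂-vertex connected xy xz yz ja jb jc a∈P b∈P c∈P
      (Vz.no-outer-neighbour none)
    ... | yes _ | no none | _ = Γc-from-degree₂-vertex connected xz xy (∼-sym yz) jb ja (joins-sym jc) b∈P a∈P c∈P
      (λ t yt → Sum.swap (Vy.no-outer-neighbour none t yt))
    ... | yes _ | yes _ | no none = Γc-from-degree₂-vertex connected yz (∼-sym xy) (∼-sym xz) jc
      (joins-sym ja) (joins-sym jb) c∈P a∈P b∈P (Vx.no-outer-neighbour none)
    ... | yes nz | yes ny | yes nx = ⊥-elim (not-all-outer-neighbours nx ny nz)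

  Γc-from-triangle : Connected F → ∀ {x y z} → x ∼ y → x ∼ z → y ∼ z → Iso (IncGraph D) Γc
  Γc-from-triangle connected {x} {y} {z} xy xz yz
    with edge-joining xy | edge-joining xz | edge-joining yz
  ... | a , ja | b , jb | c , jc with common-part (Triangle.a∼b x y z a b c xy xz yz ja jb jc)
  ... | P , a∈P , b∈P = TriangleRotations.Γc-from-rotations x y z a b c xy xz yz ja jb jc P a∈P b∈P
    (TriangleClosure.triangle-part-closed x y z a b c xy xz yz ja jb jc a∈P b∈P) connected

lemma4p12 : (F : FinGraph) → Connected F →
    (R : Edge F → Set) → (∀ x → R x → Pendant F x) →
    (D : ValidDecomposition (LineGraph F) R) →
    (∃ λ (F′ : FinGraph) → Σ (Iso (IGraph D) (LineGraph F′)) λ φ →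
        ∀ i → IsEdgePart (part D i) → Pendant F′ (Inverse.to (Σ.proj₁ φ) i)) →
    ¬ InducedSub diamond F →
    CliqueNumber F 3 →
    Iso (IncGraph D) Γc
lemma4p12 F connected R roots-pendant D (F′ , φ , pendant) diamond-free ((triangle , _ , adjacent) , K₄-free) =
  ForcedStructure.Γc-from-triangle F roots-pendant D
    (line-graph⇒claw-free D F′ φ pendant) (pendant⇒edge-parts-simplicial D F′ φ pendant)
    diamond-free K₄-free connected
    (adjacent (# 0) (# 1) λ ()) (adjacent (# 0) (# 2) λ ()) (adjacent (# 1) (# 2) λ ())
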